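{- Let $n\ge0$, let $\mathbf{k}$ be a commutative ring and $\mathcal{A}=\mathbf{k}[S_n]$. Fix compositions $\alpha,\beta$ of $n$ and let $\eta_\beta(\alpha)$ be the number of functions $f:[\ell(\beta)]\to[\ell(\alpha)]$ such that $\alpha_j=\sum_{i\in f^{ -1}(j)}\beta_i$ for every $j\in[\ell(\alpha)]$. Then left multiplication by $\mathbf{B}_\alpha$ on the quotient $\mathcal{R}_\beta\big/\sum_{\alpha'\prec\beta}\mathcal{R}_{\alpha'}$ (the sum over all compositions $\alpha'$ of $n$ strictly refining $\beta$) is well defined and equals multiplication by the scalar $\eta_\beta(\alpha)$.
   Context: $S_n$ is the symmetric group on $[n]$. For $w\in S_n$, $\operatorname{Des}(w)=\{i\in[n-1]\mid w(i)>w(i+1)\}$. A composition $\alpha=(\alpha_1,\dots,\alpha_p)$ of $n$ is a finite sequence of positive integers with sum $n$; $\ell(\alpha)=p$; $\operatorname{Set}(\alpha)=\{\alpha_1,\alpha_1+\alpha_2,\dots,\alpha_1+\cdots+\alpha_{p-1}\}$; $\mathbf{B}_\alpha=\sum_{w\in S_n,\ \operatorname{Des}(w)\subseteq\operatorname{Set}(\alpha)}w$; $\mathcal{R}_\alpha=\mathbf{B}_\alpha\mathcal{A}$. A composition $\alpha'$ refines $\beta=(\beta_1,\dots,\beta_q)$ if $\alpha'$ can be cut into $q$ contiguous subsequences whose sums are $\beta_1,\dots,\beta_q$; $\alpha'\prec\beta$ means $\alpha'$ refines $\beta$ and $\alpha'\ne\beta$. -}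

module Defs where

open import Level using (_⊔_)
open import Algebra.Bundles using (CommutativeRing)
open import Data.Nat as ℕ using (ℕ; zero; suc)
open import Data.Nat.Properties as ℕₚ using ()
open import Data.Fin as Fin using (Fin; toℕ)
open import Data.Fin.Properties as Finₚ using (all?)
open import Data.List as List using (List; []; _∷_; _++_; map; concatMap; filter; length; concat; foldr; lookup; allFin)
open import Data.List.Relation.Unary.All using (All)
open import Data.List.Membership.DecPropositional ℕₚ._≟_ using (_∈?_)
open import Data.List.Membership.Propositional using (_∈_)
open import Data.Nat.ListAction using (sum)
open import Data.Product using (Σ; ∃; _×_; _,_; proj₁; proj₂)
open import Data.Bool using (Bool; true; false; if_then_else_)
open import Relation.Nullary using (Dec; yes; no; does; ¬_)
open import Relation.Nullary.Decidable.Core using (_→-dec_)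
open import Relation.Binary.PropositionalEquality using (_≡_; _≢_)
open import Function using (_∘_)

IsComposition : ℕ → List ℕ → Set
IsComposition n α = All (0 ℕ.<_) α × sum α ≡ n

-- Set(α) = {α₁, α₁+α₂, …, α₁+⋯+α_{p-1}} (as a list)
partialSums : List ℕ → List ℕ
partialSums []            = []
partialSums (a ∷ [])      = []
partialSums (a ∷ b ∷ r)   = a ∷ map (a ℕ.+_) (partialSums (b ∷ r))

Refines : List ℕ → List ℕ → Set
Refines α' β = Σ (List (List ℕ)) λ L → concat L ≡ α' × map sum L ≡ β

StrictlyRefines : List ℕ → List ℕ → Set
StrictlyRefines α' β = Refines α' β × α' ≢ β

-- Permutations of [n] (0-indexed as Fin n), composition (u v)(i) = u (v i)

Fun : ℕ → Set
Fun n = Fin n → Fin n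

IsPerm : ∀ {n} → Fun n → Set
IsPerm {n} w = ∀ (i j : Fin n) → w i ≡ w j → i ≡ j

isPerm? : ∀ {n} (w : Fun n) → Dec (IsPerm w)
isPerm? w = all? λ i → all? λ j → (w i Fin.≟ w j) →-dec (i Fin.≟ j)

allFuns : (m k : ℕ) → List (Fin m → Fin k)
allFuns zero    k = (λ ()) ∷ []
allFuns (suc m) k =
  concatMap (λ (x : Fin k) → map (λ (g : Fin m → Fin k) → λ { Fin.zero → x ; (Fin.suc i) → g i })
                                  (allFuns m k))
            (allFin k)

permutations : (n : ℕ) → List (Fun n)
permutations n = filter isPerm? (allFuns n n)

-- Des(w) ⊆ Set(α).  Positions are 1-based: i ∈ [n-1] is a descent iff
-- w(i) > w(i+1); with 0-based indices, i ↔ toℕ a + 1 where toℕ b = toℕ a + 1.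
DesSubset : ∀ {n} → List ℕ → Fun n → Set
DesSubset {n} α w = ∀ (a b : Fin n) → toℕ b ≡ suc (toℕ a) → w b Fin.< w a →
                    suc (toℕ a) ∈ partialSums α

desSubset? : ∀ {n} (α : List ℕ) (w : Fun n) → Dec (DesSubset α w)
desSubset? α w = all? λ a → all? λ b →
  (toℕ b ℕₚ.≟ suc (toℕ a)) →-dec ((w b Finₚ.<? w a) →-dec (suc (toℕ a) ∈? partialSums α))

_≐?_ : ∀ {n} (u v : Fun n) → Dec (∀ i → u i ≡ v i)
u ≐? v = all? λ i → u i Fin.≟ v i

-- The group algebra k[S_n]: formal k-linear combinations of permutations,
-- represented as lists of (coefficient, permutation), compared by coefficients.

module GroupAlgebra {c ℓ} (K : CommutativeRing c ℓ) (n : ℕ) where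
  open CommutativeRing K renaming (Carrier to k)

  Elem : Set c
  Elem = List (k × Fun n)

  -- all terms are permutations (i.e. the element lies in k[S_n])
  InA : Elem → Set c
  InA x = All (IsPerm ∘ proj₂) x

  coeff : Elem → Fun n → k
  coeff x w = foldr (λ t acc → if does (proj₂ t ≐? w) then proj₁ t + acc else acc) 0# x

  _≈ₐ_ : Elem → Elem → Set ℓ
  x ≈ₐ y = ∀ w → coeff x w ≈ coeff y w

  zeroₐ : Elem
  zeroₐ = []

  _+ₐ_ : Elem → Elem → Elem
  x +ₐ y = x ++ y

  _*ₐ_ : Elem → Elem → Elem
  x *ₐ y = concatMap (λ s → map (λ t → (proj₁ s * proj₁ t , λ i → proj₂ s (proj₂ t i))) y) x

  _•_ : k → Elem → Elem
  r • x = map (λ t → (r * proj₁ t , proj₂ t)) x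

  _-ₐ_ : Elem → Elem → Elem
  x -ₐ y = x +ₐ ((- 1#) • y)

  sumₐ : List Elem → Elem
  sumₐ = foldr _+ₐ_ zeroₐ

  fromℕ : ℕ → k
  fromℕ zero    = 0#
  fromℕ (suc m) = 1# + fromℕ m

  B : List ℕ → Elem
  B α = map (λ w → (1# , w)) (filter (desSubset? α) (permutations n))

  InR : List ℕ → Elem → Set (c ⊔ ℓ)
  InR β x = Σ Elem λ a → InA a × x ≈ₐ (B β *ₐ a)

  InRefSum : List ℕ → Elem → Set (c ⊔ ℓ)
  InRefSum β y = Σ (List (List ℕ × Elem)) λ L →
    All (λ p → IsComposition n (proj₁ p) × StrictlyRefines (proj₁ p) β × InA (proj₂ p)) L ×
    y ≈ₐ sumₐ (map (λ p → B (proj₁ p) *ₐ proj₂ p) L)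

fiberSum : (α β : List ℕ) → (Fin (length β) → Fin (length α)) → Fin (length α) → ℕ
fiberSum α β f j = sum (map (λ i → if does (f i Fin.≟ j) then lookup β i else 0) (allFin (length β)))

η : (β α : List ℕ) → ℕ
η β α = length (filter (λ f → all? λ j → lookup α j ℕₚ.≟ fiberSum α β f j)
                       (allFuns (length β) (length α)))

-- The coefficient of a permutation p in B_α B_β a is a sum over the factorisations p = s ∘ u with
-- Des(s) ⊆ Set(α) and Des(u) ⊆ Set(β).  For fixed p such a factorisation is determined by the
-- labelling c(i) = (the block of α containing u(i)): c has content α and increases along each block
-- of β for the order comparing c first and p second, and u is recovered as the rank of i in that
-- order.  If c is constant on the blocks of β it comes from one of the η_β(α) maps [ℓ(β)] → [ℓ(α)]
-- with fibre sums α, and the condition on c says Des(p) ⊆ Set(β).  Otherwise c is weakly increasing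
-- on the blocks of β, and the condition says Des(p) ⊆ Set(γ(c)), where γ(c) ≺ β is cut at the cuts of
-- β and wherever c changes.  Hence B_α B_β a = η_β(α) B_β a + Σ_c B_{γ(c)} a.

module Submission where

open import Defs
open import Algebra.Bundles using (CommutativeRing; CommutativeMonoid)
import Algebra.Properties.AbelianGroup as AbelianGroupProperties
open import Data.Fin using (Fin)
open import Data.Fin.Properties using (all?)
open import Data.List using (List; map)
open import Data.List.Properties using (map-∘)
open import Data.Nat using (ℕ)
open import Data.Product using (_,_; proj₁; proj₂)
import Relation.Binary.PropositionalEquality as ≡
open import Relation.Binary.PropositionalEquality using (_≗_)
import Relation.Binary.Reasoning.Setoid as SetoidReasoning
open import Relation.Nullary using (Dec)

infix 4 _≗?_

_≗?_ : ∀ {m k} (f g : Fin m → Fin k) → Dec (f ≗ g)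
f ≗? g = all? λ i → f i Data.Fin.≟ g i

module ListSums {c ℓ} (M : CommutativeMonoid c ℓ) where

  open import Data.Bool using (true; false; if_then_else_)
  import Data.Fin as Fin
  open import Data.Nat using (zero; suc)
  open import Data.Product using (_×_; _,_)
  open import Data.List using ([]; _∷_; map; _++_; concatMap; filter; allFin)
  open import Data.List.Properties using (map-tabulate)
  open import Data.List.Relation.Unary.All using (All; []; _∷_)
  open import Function using (_∘_)
  open import Relation.Binary.PropositionalEquality as ≡ using (_≡_; _≗_)
  open import Function.Bundles using (_⇔_; Equivalence; mk⇔)
  open import Relation.Nullary using (Dec; yes; no; does; ¬_)
  open import Relation.Nullary.Decidable using (_×-dec_)
  open import Relation.Nullary.Negation using (contradiction)
  open import Relation.Unary using (Decidable)

  open CommutativeMonoid M renaming (Carrier to C; _∙_ to _+_; ε to 0#)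
  open import Algebra.Properties.CommutativeSemigroup commutativeSemigroup using (interchange)
  open import Relation.Binary.Reasoning.Setoid setoid

  ∑ : ∀ {a} {A : Set a} → (A → C) → List A → C
  ∑ f []       = 0#
  ∑ f (x ∷ xs) = f x + ∑ f xs

  ∑-cong : ∀ {a} {A : Set a} {f g : A → C} xs → (∀ x → f x ≈ g x) → ∑ f xs ≈ ∑ g xs
  ∑-cong []       f≈g = refl
  ∑-cong (x ∷ xs) f≈g = ∙-cong (f≈g x) (∑-cong xs f≈g)

  ∑-cong-All : ∀ {a p} {A : Set a} {P : A → Set p} {f g : A → C} {xs} →
               All P xs → (∀ x → P x → f x ≈ g x) → ∑ f xs ≈ ∑ g xs
  ∑-cong-All []         f≈g = refl
  ∑-cong-All (px ∷ pxs) f≈g = ∙-cong (f≈g _ px) (∑-cong-All pxs f≈g)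

  ∑-++ : ∀ {a} {A : Set a} (f : A → C) xs ys → ∑ f (xs ++ ys) ≈ ∑ f xs + ∑ f ys
  ∑-++ f []       ys = sym (identityˡ _)
  ∑-++ f (x ∷ xs) ys = trans (∙-congˡ (∑-++ f xs ys)) (sym (assoc _ _ _))

  ∑-0# : ∀ {a} {A : Set a} (xs : List A) → ∑ (λ _ → 0#) xs ≈ 0#
  ∑-0# []       = refl
  ∑-0# (x ∷ xs) = trans (identityˡ _) (∑-0# xs)

  ∑-+ : ∀ {a} {A : Set a} (f g : A → C) xs → ∑ (λ x → f x + g x) xs ≈ ∑ f xs + ∑ g xs
  ∑-+ f g []       = sym (identityˡ _)
  ∑-+ f g (x ∷ xs) = trans (∙-congˡ (∑-+ f g xs)) (interchange _ _ _ _)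

  ∑-map : ∀ {a b} {A : Set a} {B : Set b} (f : B → C) (g : A → B) xs → ∑ f (map g xs) ≈ ∑ (f ∘ g) xs
  ∑-map f g []       = refl
  ∑-map f g (x ∷ xs) = ∙-congˡ (∑-map f g xs)

  ∑-concatMap : ∀ {a b} {A : Set a} {B : Set b} (f : B → C) (g : A → List B) xs →
                ∑ f (concatMap g xs) ≈ ∑ (λ x → ∑ f (g x)) xs
  ∑-concatMap f g []       = refl
  ∑-concatMap f g (x ∷ xs) = trans (∑-++ f (g x) (concatMap g xs)) (∙-congˡ (∑-concatMap f g xs))

  ∑-swap : ∀ {a b} {A : Set a} {B : Set b} (f : A → B → C) xs ys →
           ∑ (λ x → ∑ (f x) ys) xs ≈ ∑ (λ y → ∑ (λ x → f x y) xs) ys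
  ∑-swap f []       ys = sym (∑-0# ys)
  ∑-swap f (x ∷ xs) ys = trans (∙-congˡ (∑-swap f xs ys)) (sym (∑-+ (f x) _ ys))

  when : ∀ {p} {P : Set p} → Dec P → C → C
  when P? x = if does P? then x else 0#

  when-cong : ∀ {p q} {P : Set p} {Q : Set q} (P? : Dec P) (Q? : Dec Q) {x y} →
              P ⇔ Q → x ≈ y → when P? x ≈ when Q? y
  when-cong (yes _) (yes _) _   x≈y = x≈y
  when-cong (no _)  (no _)  _   _   = refl
  when-cong (yes p) (no ¬q) P⇔Q _   = contradiction (Equivalence.to P⇔Q p) ¬q
  when-cong (no ¬p) (yes q) P⇔Q _   = contradiction (Equivalence.from P⇔Q q) ¬p

  when-¬ : ∀ {p} {P : Set p} (P? : Dec P) {x} → ¬ P → when P? x ≈ 0#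
  when-¬ (yes p) ¬p = contradiction p ¬p
  when-¬ (no _)  ¬p = refl

  when-congʳ : ∀ {p} {P : Set p} (P? : Dec P) {x y} → x ≈ y → when P? x ≈ when P? y
  when-congʳ (yes _) x≈y = x≈y
  when-congʳ (no _)  x≈y = refl

  when-×-dec : ∀ {p q} {P : Set p} {Q : Set q} (P? : Dec P) (Q? : Dec Q) {x} →
               when (P? ×-dec Q?) x ≈ when P? (when Q? x)
  when-×-dec (yes _) Q? = refl
  when-×-dec (no _)  Q? = refl

  ∑-when : ∀ {a p} {A : Set a} {P : Set p} (P? : Dec P) (f : A → C) xs → ∑ (λ x → when P? (f x)) xs ≈ when P? (∑ f xs)
  ∑-when (yes _) f xs = refl
  ∑-when (no _)  f xs = ∑-0# xs

  ∑-filter : ∀ {a p} {A : Set a} {P : A → Set p} (P? : Decidable P) (f : A → C) xs →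
             ∑ f (filter P? xs) ≈ ∑ (λ x → when (P? x) (f x)) xs
  ∑-filter P? f []       = refl
  ∑-filter P? f (x ∷ xs) with does (P? x)
  ... | true  = ∙-congˡ (∑-filter P? f xs)
  ... | false = trans (∑-filter P? f xs) (sym (identityˡ _))

  ∑-allFin-suc : ∀ {k} (h : Fin (suc k) → C) → ∑ h (allFin (suc k)) ≈ h Fin.zero + ∑ (h ∘ Fin.suc) (allFin k)
  ∑-allFin-suc {k} h =
    ∙-congˡ (trans (reflexive (≡.cong (∑ h) (≡.sym (map-tabulate (λ i → i) Fin.suc)))) (∑-map h Fin.suc (allFin k)))

  ∑-allFin-δ : ∀ {k} (y : Fin k) (h : Fin k → C) → ∑ (λ x → when (x Fin.≟ y) (h x)) (allFin k) ≈ h y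
  ∑-allFin-δ {suc k} Fin.zero h =
    trans (∑-allFin-suc (λ x → when (x Fin.≟ Fin.zero) (h x))) (trans (∙-congˡ (∑-0# (allFin k))) (identityʳ _))
  ∑-allFin-δ {suc k} (Fin.suc y) h =
    trans (∑-allFin-suc (λ x → when (x Fin.≟ Fin.suc y) (h x))) (trans (identityˡ _) (∑-allFin-δ y (h ∘ Fin.suc)))

  ∑-allFuns-δ : ∀ m k (g : Fin m → Fin k) (h : (Fin m → Fin k) → C) → (∀ {f f′} → f ≗ f′ → h f ≈ h f′) →
                ∑ (λ f → when (f ≗? g) (h f)) (allFuns m k) ≈ h g
  ∑-allFuns-δ zero    k g h h-resp = trans (identityʳ _) (h-resp λ ())
  ∑-allFuns-δ (suc m) k g h h-resp = cons-δ _ (λ _ _ → ≡.refl) (λ _ _ _ → ≡.refl)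
    where
    -- allFuns extends maps by a pattern-matching lambda, which can only be named through unification.
    cons-δ : (cons : Fin k → (Fin m → Fin k) → Fin (suc m) → Fin k) →
             (∀ x g′ → cons x g′ Fin.zero ≡ x) → (∀ x g′ i → cons x g′ (Fin.suc i) ≡ g′ i) →
             ∑ (λ f → when (f ≗? g) (h f)) (concatMap (λ x → map (λ g′ → cons x g′) (allFuns m k)) (allFin k)) ≈ h g
    cons-δ cons cons-zero cons-suc = begin
      ∑ (λ f → when (f ≗? g) (h f)) (concatMap (λ x → map (cons x) (allFuns m k)) (allFin k))
        ≈⟨ ∑-concatMap _ _ (allFin k) ⟩
      ∑ (λ x → ∑ (λ f → when (f ≗? g) (h f)) (map (cons x) (allFuns m k))) (allFin k)
        ≈⟨ ∑-cong (allFin k) (λ x → ∑-map _ _ (allFuns m k)) ⟩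
      ∑ (λ x → ∑ (λ g′ → when (cons x g′ ≗? g) (h (cons x g′))) (allFuns m k)) (allFin k)
        ≈⟨ ∑-cong (allFin k) (λ x → ∑-cong (allFuns m k) (λ g′ →
             trans (when-cong (cons x g′ ≗? g) (x Fin.≟ g Fin.zero ×-dec g′ ≗? g ∘ Fin.suc) (cons-≗ x g′) refl)
                   (when-×-dec (x Fin.≟ g Fin.zero) (g′ ≗? g ∘ Fin.suc)))) ⟩
      ∑ (λ x → ∑ (λ g′ → when (x Fin.≟ g Fin.zero) (when (g′ ≗? g ∘ Fin.suc) (h (cons x g′)))) (allFuns m k)) (allFin k)
        ≈⟨ ∑-cong (allFin k) (λ x → trans (∑-when (x Fin.≟ g Fin.zero) _ (allFuns m k))
             (when-congʳ (x Fin.≟ g Fin.zero)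
               (∑-allFuns-δ m k (g ∘ Fin.suc) (h ∘ cons x) (λ f≗f′ → h-resp (cons-resp x f≗f′))))) ⟩
      ∑ (λ x → when (x Fin.≟ g Fin.zero) (h (cons x (g ∘ Fin.suc)))) (allFin k)
        ≈⟨ ∑-allFin-δ (g Fin.zero) _ ⟩
      h (cons (g Fin.zero) (g ∘ Fin.suc))
        ≈⟨ h-resp (λ { Fin.zero → cons-zero _ _ ; (Fin.suc i) → cons-suc _ _ i }) ⟩
      h g ∎
      where
      cons-resp : ∀ x {f f′} → f ≗ f′ → cons x f ≗ cons x f′
      cons-resp x {f} {f′} f≗f′ Fin.zero    = ≡.trans (cons-zero x f) (≡.sym (cons-zero x f′))
      cons-resp x {f} {f′} f≗f′ (Fin.suc i) = ≡.trans (cons-suc x f i) (≡.trans (f≗f′ i) (≡.sym (cons-suc x f′ i)))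
      cons-≗ : ∀ x g′ → (cons x g′ ≗ g) ⇔ (x ≡ g Fin.zero × g′ ≗ g ∘ Fin.suc)
      cons-≗ x g′ = mk⇔
        (λ eq → ≡.trans (≡.sym (cons-zero x g′)) (eq Fin.zero) , λ i → ≡.trans (≡.sym (cons-suc x g′ i)) (eq (Fin.suc i)))
        (λ { (x≡ , g′≗) Fin.zero    → ≡.trans (cons-zero x g′) x≡
           ; (x≡ , g′≗) (Fin.suc i) → ≡.trans (cons-suc x g′ i) (g′≗ i) })

module Combinatorics where

  open import Data.Bool using (Bool; true; false; if_then_else_)
  open import Data.Empty using (⊥-elim)
  open import Data.Fin as Fin using (Fin; toℕ; fromℕ<)
  import Data.Fin.Properties as Finₚ
  open import Data.Fin.Permutation using (permutation)
  open import Level using (_⊔_)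
  open import Data.List using ([]; _∷_; map; take; length; lookup; concat; concatMap; allFin; filter)
  import Data.List.Properties as Listₚ
  open import Data.List.Membership.Propositional using (_∈_; _∉_)
  open import Data.List.Membership.Propositional.Properties using (∈-map⁺; ∈-map⁻)
  open import Data.List.Relation.Unary.All using (All; []; _∷_)
  import Data.List.Relation.Unary.All.Properties as Allₚ
  open import Data.List.Relation.Unary.Any using (here; there)
  open import Data.Nat.ListAction using (sum)
  open import Data.Maybe as Maybe using (Maybe; just; nothing; fromMaybe)
  open import Data.Nat using (zero; suc; _+_; _*_; _∸_; _≤_; _<_; z≤n; s≤s; _<?_; _≤?_)
  open import Data.Nat.Properties
  open import Data.List.Membership.DecPropositional _≟_ using (_∈?_)
  open import Data.Product using (∃-syntax; _×_; _,_; proj₁; proj₂)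
  open import Data.Sum using (_⊎_; inj₁; inj₂; [_,_])
  open import Function using (_∘_; case_of_)
  open import Relation.Binary using (tri<; tri≈; tri>)
  open import Relation.Binary.PropositionalEquality hiding ([_])
  open import Relation.Nullary using (Dec; yes; no; does; ¬_)
  open import Relation.Nullary.Decidable using (dec-true; dec-false; does-⇔; _×-dec_; _⊎-dec_; _→-dec_; ¬?)
  open import Relation.Nullary.Negation using (contradiction)
  open import Function.Bundles using (_⇔_; mk⇔; Equivalence)
  open import Algebra.Properties.CommutativeMonoid.Sum +-0-commutativeMonoid using (sum-cong-≗; sum-permute) renaming (sum to sumᵛ)

  open ListSums +-0-commutativeMonoid public

  -- Counting

  sum-map≡∑ : ∀ {a} {A : Set a} (h : A → ℕ) xs → sum (map h xs) ≡ ∑ h xs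
  sum-map≡∑ h []       = refl
  sum-map≡∑ h (x ∷ xs) = cong (h x +_) (sum-map≡∑ h xs)

  𝟙 : Bool → ℕ
  𝟙 b = if b then 1 else 0

  true⇒witness : ∀ {a} {A : Set a} (a? : Dec A) → does a? ≡ true → A
  true⇒witness (yes a) _ = a

  count : ∀ {n} → (Fin n → Bool) → ℕ
  count P = sumᵛ (𝟙 ∘ P)

  count-cong : ∀ {n} {P Q : Fin n → Bool} → P ≗ Q → count P ≡ count Q
  count-cong P≗Q = sum-cong-≗ (cong 𝟙 ∘ P≗Q)

  count-false : ∀ {n} {P : Fin n → Bool} → (∀ q → P q ≡ false) → count P ≡ 0
  count-false {zero}  P≡false = refl
  count-false {suc n} P≡false rewrite P≡false Fin.zero = count-false (P≡false ∘ Fin.suc)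

  count-true : ∀ {n} → count {n} (λ _ → true) ≡ n
  count-true {zero}  = refl
  count-true {suc n} = cong suc (count-true {n})

  𝟙-mono : ∀ {a b : Bool} → (a ≡ true → b ≡ true) → 𝟙 a ≤ 𝟙 b
  𝟙-mono {false}         _   = z≤n
  𝟙-mono {true} {true}   _   = s≤s z≤n
  𝟙-mono {true} {false}  a⇒b with () ← a⇒b refl

  count-mono : ∀ {n} {P Q : Fin n → Bool} → (∀ q → P q ≡ true → Q q ≡ true) → count P ≤ count Q
  count-mono {zero}  P⇒Q = z≤n
  count-mono {suc n} P⇒Q = +-mono-≤ (𝟙-mono (P⇒Q Fin.zero)) (count-mono (P⇒Q ∘ Fin.suc))

  count-mono-< : ∀ {n} {P Q : Fin n → Bool} → (∀ q → P q ≡ true → Q q ≡ true) →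
                 ∀ x → P x ≡ false → Q x ≡ true → count P < count Q
  count-mono-< {suc n} P⇒Q Fin.zero    Px Qx rewrite Px | Qx = s≤s (count-mono (P⇒Q ∘ Fin.suc))
  count-mono-< {suc n} P⇒Q (Fin.suc x) Px Qx =
    +-mono-≤-< (𝟙-mono (P⇒Q Fin.zero)) (count-mono-< (P⇒Q ∘ Fin.suc) x Px Qx)

  count<n : ∀ {n} (P : Fin n → Bool) x → P x ≡ false → count P < n
  count<n {n} P x Px = subst (count P <_) count-true (count-mono-< (λ _ _ → refl) x Px refl)

  count-⊎ : ∀ {n p q} {P : Fin n → Set p} {Q : Fin n → Set q} (P? : ∀ i → Dec (P i)) (Q? : ∀ i → Dec (Q i)) →
            (∀ i → P i → ¬ Q i) → count (λ i → does (P? i ⊎-dec Q? i)) ≡ count (does ∘ P?) + count (does ∘ Q?)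
  count-⊎ {zero}  P? Q? disjoint = refl
  count-⊎ {suc n} P? Q? disjoint with P? Fin.zero | Q? Fin.zero
  ... | yes P0 | yes Q0 = contradiction Q0 (disjoint Fin.zero P0)
  ... | yes _  | no _   = cong suc (count-⊎ (P? ∘ Fin.suc) (Q? ∘ Fin.suc) (disjoint ∘ Fin.suc))
  ... | no _   | yes _  = trans (cong suc (count-⊎ (P? ∘ Fin.suc) (Q? ∘ Fin.suc) (disjoint ∘ Fin.suc))) (sym (+-suc _ _))
  ... | no _   | no _   = count-⊎ (P? ∘ Fin.suc) (Q? ∘ Fin.suc) (disjoint ∘ Fin.suc)

  count-< : ∀ {n} (x : Fin n) → count {n} (λ q → does (q Fin.<? x)) ≡ toℕ x
  count-< {suc n} Fin.zero    = count-false λ (q : Fin (suc n)) → dec-false (q Fin.<? Fin.zero {n}) λ ()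
  count-< {suc n} (Fin.suc x) =
    cong suc (trans (count-cong {P = λ (q : Fin n) → does (Fin.suc q Fin.<? Fin.suc x)} λ _ → refl) (count-< x))

  # : ∀ {a p} {A : Set a} {P : A → Set p} → (∀ x → Dec (P x)) → List A → ℕ
  # P? = ∑ (λ x → when (P? x) 1)

  #-cong : ∀ {a p q} {A : Set a} {P : A → Set p} {Q : A → Set q} (P? : ∀ x → Dec (P x)) (Q? : ∀ x → Dec (Q x)) →
           (∀ x → P x ⇔ Q x) → ∀ xs → # P? xs ≡ # Q? xs
  #-cong P? Q? P⇔Q xs = ∑-cong xs λ x → when-cong (P? x) (Q? x) (P⇔Q x) refl

  #-split : ∀ {a p q} {A : Set a} {P : A → Set p} {Q : A → Set q} (P? : ∀ x → Dec (P x)) (Q? : ∀ x → Dec (Q x)) →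
            ∀ xs → # P? xs ≡ # (λ x → P? x ×-dec Q? x) xs + # (λ x → P? x ×-dec ¬? (Q? x)) xs
  #-split P? Q? xs = trans (∑-cong xs split) (∑-+ _ _ xs)
    where
    split : ∀ x → when (P? x) 1 ≡ when (P? x ×-dec Q? x) 1 + when (P? x ×-dec ¬? (Q? x)) 1
    split x with P? x | Q? x
    ... | yes _ | yes _ = refl
    ... | yes _ | no _  = refl
    ... | no _  | _     = refl

  #-filter : ∀ {a p q} {A : Set a} {P : A → Set p} {Q : A → Set q} (P? : ∀ x → Dec (P x)) (Q? : ∀ x → Dec (Q x)) →
             ∀ xs → # Q? (filter P? xs) ≡ # (λ x → P? x ×-dec Q? x) xs
  #-filter P? Q? xs = trans (∑-filter P? _ xs) (∑-cong xs λ x → sym (when-×-dec (P? x) (Q? x)))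

  #-const : ∀ {a p q} {A : Set a} {P : Set p} {Q : A → Set q} (P? : Dec P) (Q? : ∀ x → Dec (Q x)) →
            ∀ xs → # (λ x → P? ×-dec Q? x) xs ≡ when P? (# Q? xs)
  #-const P? Q? xs = trans (∑-cong xs λ x → when-×-dec P? (Q? x)) (∑-when P? _ xs)

  #-none : ∀ {a p} {A : Set a} {P : A → Set p} (P? : ∀ x → Dec (P x)) → (∀ x → ¬ P x) → ∀ xs → # P? xs ≡ 0
  #-none P? ¬P xs = trans (∑-cong xs λ x → when-¬ (P? x) (¬P x)) (∑-0# xs)

  *-when : ∀ {p} {P : Set p} (P? : Dec P) m → m * when P? 1 ≡ when P? m
  *-when (yes _) m = *-identityʳ m
  *-when (no _)  m = *-zeroʳ m

  length-filter≡# : ∀ {a p} {A : Set a} {P : A → Set p} (P? : ∀ x → Dec (P x)) xs → length (filter P? xs) ≡ # P? xs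
  length-filter≡# P? xs = trans (∑1≡length (filter P? xs)) (∑-filter P? _ xs)
    where
    ∑1≡length : ∀ {a} {A : Set a} (ys : List A) → length ys ≡ ∑ (λ _ → 1) ys
    ∑1≡length []       = refl
    ∑1≡length (y ∷ ys) = cong suc (∑1≡length ys)

  record Correspondence {m k m′ k′ p q} (P : (Fin m → Fin k) → Set p) (Q : (Fin m′ → Fin k′) → Set q) : Set (p ⊔ q) where
    field
      to        : (Fin m → Fin k) → (Fin m′ → Fin k′)
      from      : (Fin m′ → Fin k′) → (Fin m → Fin k)
      to-cong   : ∀ {f f′} → f ≗ f′ → to f ≗ to f′
      from-cong : ∀ {g g′} → g ≗ g′ → from g ≗ from g′
      to-∈      : ∀ {f} → P f → Q (to f)
      from-∈    : ∀ {g} → Q g → P (from g)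
      from∘to   : ∀ {f} → P f → from (to f) ≗ f
      to∘from   : ∀ {g} → Q g → to (from g) ≗ g

  Respects≗ : ∀ {m k p} → ((Fin m → Fin k) → Set p) → Set p
  Respects≗ P = ∀ {f f′} → f ≗ f′ → P f → P f′

  #-correspondence : ∀ {m k m′ k′ p q} {P : (Fin m → Fin k) → Set p} {Q : (Fin m′ → Fin k′) → Set q}
    (P? : ∀ f → Dec (P f)) (Q? : ∀ g → Dec (Q g)) → Respects≗ P → Respects≗ Q →
    Correspondence P Q → # P? (allFuns m k) ≡ # Q? (allFuns m′ k′)
  #-correspondence {m} {k} {m′} {k′} {P = P} {Q} P? Q? P-resp Q-resp corr = begin
    ∑ (λ f → when (P? f) 1) (allFuns m k)
      ≡⟨ ∑-cong (allFuns m k) (λ f → cong (when (P? f)) (∑-allFuns-δ m′ k′ (to f) (λ _ → 1) (λ _ → refl))) ⟨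
    ∑ (λ f → when (P? f) (∑ (λ g → when (g ≗? to f) 1) (allFuns m′ k′))) (allFuns m k)
      ≡⟨ ∑-cong (allFuns m k) (λ f → ∑-when (P? f) _ (allFuns m′ k′)) ⟨
    ∑ (λ f → ∑ (λ g → when (P? f) (when (g ≗? to f) 1)) (allFuns m′ k′)) (allFuns m k)
      ≡⟨ ∑-swap (λ f g → when (P? f) (when (g ≗? to f) 1)) (allFuns m k) (allFuns m′ k′) ⟩
    ∑ (λ g → ∑ (λ f → when (P? f) (when (g ≗? to f) 1)) (allFuns m k)) (allFuns m′ k′)
      ≡⟨ ∑-cong (allFuns m′ k′) fibre ⟩
    ∑ (λ g → when (Q? g) 1) (allFuns m′ k′) ∎
    where
    open Correspondence corr
    open ≡-Reasoning
    fibre : ∀ g → ∑ (λ f → when (P? f) (when (g ≗? to f) 1)) (allFuns m k) ≡ when (Q? g) 1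
    fibre g with Q? g
    ... | yes Qg = trans (∑-cong (allFuns m k) λ f → trans (sym (when-×-dec (P? f) (g ≗? to f)))
                           (when-cong (P? f ×-dec g ≗? to f) (f ≗? from g) (fibre⇔ f) refl))
                         (∑-allFuns-δ m k (from g) (λ _ → 1) (λ _ → refl))
      where
      fibre⇔ : ∀ f → (P f × g ≗ to f) ⇔ f ≗ from g
      fibre⇔ f = mk⇔ (λ (Pf , g≗tof) i → trans (sym (from∘to Pf i)) (from-cong (λ j → sym (g≗tof j)) i))
                     (λ f≗ → P-resp (λ i → sym (f≗ i)) (from-∈ Qg) ,
                             λ i → trans (sym (to∘from Qg i)) (to-cong (λ j → sym (f≗ j)) i))
    ... | no ¬Qg = trans (∑-cong (allFuns m k) none) (∑-0# (allFuns m k))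
      where
      none : ∀ f → when (P? f) (when (g ≗? to f) 1) ≡ 0
      none f = trans (sym (when-×-dec (P? f) (g ≗? to f)))
                     (when-¬ (P? f ×-dec g ≗? to f) λ (Pf , g≗tof) → ¬Qg (Q-resp (λ i → sym (g≗tof i)) (to-∈ Pf)))

  multiplicity : ∀ {n} → List (Fun n) → Fun n → ℕ
  multiplicity Z q = # (q ≗?_) Z

  -- Inverses and ranks

  find : ∀ {n p} {P : Fin n → Set p} → (∀ i → Dec (P i)) → Maybe (Fin n)
  find {zero}  P? = nothing
  find {suc n} P? = if does (P? Fin.zero) then just Fin.zero else Maybe.map Fin.suc (find (P? ∘ Fin.suc))

  find-cong : ∀ {n p q} {P : Fin n → Set p} {Q : Fin n → Set q} (P? : ∀ i → Dec (P i)) (Q? : ∀ i → Dec (Q i)) →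
              (∀ i → P i ⇔ Q i) → find P? ≡ find Q?
  find-cong {zero}  P? Q? P⇔Q = refl
  find-cong {suc n} P? Q? P⇔Q
    rewrite does-⇔ (P⇔Q Fin.zero) (P? Fin.zero) (Q? Fin.zero)
          | find-cong (P? ∘ Fin.suc) (Q? ∘ Fin.suc) (P⇔Q ∘ Fin.suc) = refl

  find-sound : ∀ {n p} {P : Fin n → Set p} (P? : ∀ i → Dec (P i)) {i} → find P? ≡ just i → P i
  find-sound {suc n} P? eq with P? Fin.zero
  find-sound {suc n} P? refl | yes P0 = P0
  ... | no _ with find (P? ∘ Fin.suc) in found
  find-sound {suc n} P? refl | no _ | just j = find-sound (P? ∘ Fin.suc) found

  find-complete : ∀ {n p} {P : Fin n → Set p} (P? : ∀ i → Dec (P i)) i → P i → ∃[ j ] find P? ≡ just j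
  find-complete {suc n} P? i Pi with P? Fin.zero
  ... | yes _ = Fin.zero , refl
  find-complete {suc n} P? Fin.zero    Pi | no ¬P0 = contradiction Pi ¬P0
  find-complete {suc n} P? (Fin.suc i) Pi | no _ with j , found ← find-complete (P? ∘ Fin.suc) i Pi
    = Fin.suc j , cong (Maybe.map Fin.suc) found

  inv : ∀ {n} → Fun n → Fun n
  inv w j = fromMaybe j (find (λ i → w i Fin.≟ j))

  inv-cong : ∀ {n} {w w′ : Fun n} → w ≗ w′ → inv w ≗ inv w′
  inv-cong {w = w} {w′} w≗w′ j =
    cong (fromMaybe j) (find-cong (λ i → w i Fin.≟ j) (λ i → w′ i Fin.≟ j)
      λ i → mk⇔ (trans (sym (w≗w′ i))) (trans (w≗w′ i)))

  IsPerm-surjective : ∀ {n} {w : Fun n} → IsPerm w → ∀ j → ∃[ i ] w i ≡ j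
  IsPerm-surjective {suc m} {w} w-inj j with Finₚ.any? (λ i → w i Fin.≟ j)
  ... | yes found = found
  ... | no ¬found = contradiction (Finₚ.injective⇒≤ {f = missJ} missJ-injective) 1+n≰n
    where
    j∉image : ∀ i → j ≢ w i
    j∉image i j≡wi = ¬found (i , sym j≡wi)
    missJ : Fin (suc m) → Fin m
    missJ i = Fin.punchOut (j∉image i)
    missJ-injective : ∀ {x y} → missJ x ≡ missJ y → x ≡ y
    missJ-injective eq = w-inj _ _ (Finₚ.punchOut-injective (j∉image _) (j∉image _) eq)

  ∘-inv : ∀ {n} {w : Fun n} → IsPerm w → ∀ j → w (inv w j) ≡ j
  ∘-inv {w = w} w-inj j with i , wi≡j ← IsPerm-surjective w-inj j
    with k , found ← find-complete (λ i → w i Fin.≟ j) i wi≡j rewrite found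
    = find-sound (λ i → w i Fin.≟ j) found

  inv-∘ : ∀ {n} {w : Fun n} → IsPerm w → ∀ i → inv w (w i) ≡ i
  inv-∘ {w = w} w-inj i = w-inj (inv w (w i)) i (∘-inv w-inj (w i))

  IsPerm-inv : ∀ {n} {w : Fun n} → IsPerm w → IsPerm (inv w)
  IsPerm-inv {w = w} w-inj i j eq = trans (sym (∘-inv w-inj i)) (trans (cong w eq) (∘-inv w-inj j))

  IsPerm-∘ : ∀ {n} {u v : Fun n} → IsPerm u → IsPerm v → IsPerm (u ∘ v)
  IsPerm-∘ u-inj v-inj i j eq = v-inj i j (u-inj _ _ eq)

  IsPerm-resp : ∀ {n} {w w′ : Fun n} → w ≗ w′ → IsPerm w → IsPerm w′
  IsPerm-resp w≗w′ w-inj i j eq = w-inj i j (trans (w≗w′ i) (trans eq (sym (w≗w′ j))))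

  inv-of-∘ : ∀ {n} {u v : Fun n} → IsPerm u → IsPerm v → ∀ j → inv (u ∘ v) j ≡ inv v (inv u j)
  inv-of-∘ {u = u} {v} u-inj v-inj j =
    trans (cong (inv (u ∘ v)) (sym uv-inv)) (inv-∘ (IsPerm-∘ u-inj v-inj) (inv v (inv u j)))
    where
    uv-inv : u (v (inv v (inv u j))) ≡ j
    uv-inv = trans (cong u (∘-inv v-inj (inv u j))) (∘-inv u-inj j)

  count-∘-perm : ∀ {n} (P : Fin n → Bool) {w : Fun n} → IsPerm w → count (P ∘ w) ≡ count P
  count-∘-perm P {w} w-inj = sym (sum-permute (𝟙 ∘ P) (permutation w (inv w) (∘-inv w-inj) (inv-∘ w-inj)))

  DesSubset-resp : ∀ {n} (γ : List ℕ) {w w′ : Fun n} → w ≗ w′ → DesSubset γ w → DesSubset γ w′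
  DesSubset-resp γ w≗w′ des a b adj w′b<w′a = des a b adj (subst₂ Fin._<_ (sym (w≗w′ b)) (sym (w≗w′ a)) w′b<w′a)

  module Rank {n r} (_≺_ : Fin n → Fin n → Set r) (_≺?_ : ∀ a b → Dec (a ≺ b))
              (≺-irrefl : ∀ a → ¬ a ≺ a) (≺-trans : ∀ {a b c} → a ≺ b → b ≺ c → a ≺ c)
              (≺-connex : ∀ {a b} → a ≢ b → a ≺ b ⊎ b ≺ a) where

    StrictlyMonotone : Fun n → Set r
    StrictlyMonotone u = ∀ {a b} → a ≺ b → u a Fin.< u b

    monotone-reflects : ∀ {u} → StrictlyMonotone u → ∀ {a b} → u a Fin.< u b → a ≺ b
    monotone-reflects {u} mono {a} {b} ua<ub with a Fin.≟ b
    ... | yes refl = contradiction ua<ub (<-irrefl refl)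
    ... | no a≢b with ≺-connex a≢b
    ... | inj₁ a≺b = a≺b
    ... | inj₂ b≺a = contradiction ua<ub (<⇒≯ (mono b≺a))

    monotone⇒IsPerm : ∀ {u} → StrictlyMonotone u → IsPerm u
    monotone⇒IsPerm mono a b ua≡ub with a Fin.≟ b
    ... | yes a≡b = a≡b
    ... | no a≢b with ≺-connex a≢b
    ... | inj₁ a≺b = contradiction (cong toℕ ua≡ub) (<⇒≢ (mono a≺b))
    ... | inj₂ b≺a = contradiction (cong toℕ (sym ua≡ub)) (<⇒≢ (mono b≺a))

    below : Fin n → Fin n → Bool
    below q a = does (a ≺? q)

    rank : Fun n
    rank q = fromℕ< (count<n (below q) q (dec-false (q ≺? q) (≺-irrefl q)))

    toℕ-rank : ∀ q → toℕ (rank q) ≡ count (below q)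
    toℕ-rank q = Finₚ.toℕ-fromℕ< _

    rank-monotone : StrictlyMonotone rank
    rank-monotone {a} {b} a≺b = subst₂ _<_ (sym (toℕ-rank a)) (sym (toℕ-rank b))
      (count-mono-< (λ x x≺a → dec-true (x ≺? b) (≺-trans (true⇒witness (x ≺? a) x≺a) a≺b)) a
                    (dec-false (a ≺? a) (≺-irrefl a)) (dec-true (a ≺? b) a≺b))

    rank-IsPerm : IsPerm rank
    rank-IsPerm = monotone⇒IsPerm rank-monotone

    rank-unique : ∀ {u} → IsPerm u → StrictlyMonotone u → u ≗ rank
    rank-unique {u} u-inj mono q = Finₚ.toℕ-injective (begin
      toℕ (u q)                                 ≡⟨ count-< (u q) ⟨
      count {n} (λ a → does (a Fin.<? u q))       ≡⟨ count-∘-perm (λ a → does (a Fin.<? u q)) u-inj ⟨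
      count {n} (λ a → does (u a Fin.<? u q))     ≡⟨ count-cong (λ a → does-⇔ (mk⇔ (monotone-reflects mono) mono) (u a Fin.<? u q) (a ≺? q)) ⟩
      count (below q)                           ≡⟨ toℕ-rank q ⟨
      toℕ (rank q)                              ∎)
      where open ≡-Reasoning

  -- Compositions and their blocks

  Positive : List ℕ → Set
  Positive = All (0 <_)

  ∈-partialSums⇒head≤ : ∀ g γ x → x ∈ partialSums (g ∷ γ) → g ≤ x
  ∈-partialSums⇒head≤ g [] x ()
  ∈-partialSums⇒head≤ g (h ∷ r) x (here refl) = ≤-refl
  ∈-partialSums⇒head≤ g (h ∷ r) x (there m) with ∈-map⁻ (g +_) m
  ... | y , _ , refl = m≤m+n g y

  ∈-partialSums⇒<sum : ∀ γ x → Positive γ → x ∈ partialSums γ → x < sum γ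
  ∈-partialSums⇒<sum [] x _ ()
  ∈-partialSums⇒<sum (g ∷ []) x _ ()
  ∈-partialSums⇒<sum (g ∷ h ∷ r) x (pg ∷ ph ∷ pr) (here refl) = m<m+n g (<-≤-trans ph (m≤m+n h (sum r)))
  ∈-partialSums⇒<sum (g ∷ h ∷ r) x (pg ∷ pr) (there m) with ∈-map⁻ (g +_) m
  ... | y , ym , refl = +-monoʳ-< g (∈-partialSums⇒<sum (h ∷ r) y pr ym)

  ∈-partialSums⇒positive : ∀ γ x → Positive γ → x ∈ partialSums γ → 0 < x
  ∈-partialSums⇒positive (g ∷ γ) x (pg ∷ _) m = <-≤-trans pg (∈-partialSums⇒head≤ g γ x m)

  partialSums-+head : ∀ c y ys → partialSums (c + y ∷ ys) ≡ map (c +_) (partialSums (y ∷ ys))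
  partialSums-+head c y [] = refl
  partialSums-+head c y (h ∷ r) = cong ((c + y) ∷_) (begin
    map ((c + y) +_) (partialSums (h ∷ r)) ≡⟨ Listₚ.map-cong (λ z → +-assoc c y z) (partialSums (h ∷ r)) ⟩
    map (λ z → c + (y + z)) (partialSums (h ∷ r)) ≡⟨ Listₚ.map-∘ (partialSums (h ∷ r)) ⟩
    map (c +_) (map (y +_) (partialSums (h ∷ r))) ∎)
    where open ≡-Reasoning

  ∈-partialSums-∷⁺ : ∀ g h r y → y ∈ partialSums (h ∷ r) → g + y ∈ partialSums (g ∷ h ∷ r)
  ∈-partialSums-∷⁺ g h r y m = there (∈-map⁺ (g +_) m)

  ∈-partialSums-∷⁻ : ∀ g h r y → 0 < y → g + y ∈ partialSums (g ∷ h ∷ r) → y ∈ partialSums (h ∷ r)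
  ∈-partialSums-∷⁻ g h r y y>0 (here e) = contradiction (+-cancelˡ-≡ g y 0 (trans e (sym (+-identityʳ g)))) (>⇒≢ y>0)
  ∈-partialSums-∷⁻ g h r y y>0 (there m) with ∈-map⁻ (g +_) m
  ... | z , zm , e rewrite +-cancelˡ-≡ g y z e = zm

  block : List ℕ → ℕ → ℕ
  block [] m = 0
  block (g ∷ γ) m with m <? g
  ... | yes _ = 0
  ... | no _ = suc (block γ (m ∸ g))

  start : List ℕ → ℕ → ℕ
  start γ i = sum (take i γ)

  block-0 : ∀ γ → Positive γ → block γ 0 ≡ 0
  block-0 [] _ = refl
  block-0 (g ∷ γ) (pg ∷ _) with 0 <? g
  ... | yes _ = refl
  ... | no ¬p = contradiction pg ¬p

  suc-∸ : ∀ m g → g ≤ m → suc m ∸ g ≡ suc (m ∸ g)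
  suc-∸ m g g≤m = +-∸-assoc 1 g≤m

  +-suc-∸ : ∀ {g m} → ¬ m < g → g + suc (m ∸ g) ≡ suc m
  +-suc-∸ m≮g = trans (+-suc _ _) (cong suc (m+[n∸m]≡n (≮⇒≥ m≮g)))

  ∸-< : ∀ {g m} r → ¬ m < g → m < g + sum r → m ∸ g < sum r
  ∸-< {g} r m≮g m<Σ = +-cancelˡ-< g _ _ (subst (_< g + sum r) (sym (m+[n∸m]≡n (≮⇒≥ m≮g))) m<Σ)

  suc-∸-< : ∀ {g m} r → ¬ m < g → suc m < g + sum r → suc (m ∸ g) < sum r
  suc-∸-< {g} r m≮g m+1<Σ = +-cancelˡ-< g _ _ (subst (_< g + sum r) (sym (+-suc-∸ m≮g)) m+1<Σ)

  block-suc-∈ : ∀ γ m → Positive γ → suc m < sum γ → suc m ∈ partialSums γ → block γ (suc m) ≡ suc (block γ m)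
  block-suc-∈ (g ∷ γ) m (_ ∷ γ>0) m+1<Σ m+1∈ with suc m <? g | m <? g
  ... | yes m+1<g | _     = contradiction (∈-partialSums⇒head≤ g γ (suc m) m+1∈) (<⇒≱ m+1<g)
  ... | no m+1≮g | yes m<g rewrite ≤-antisym (≮⇒≥ m+1≮g) m<g | n∸n≡0 (suc m) = cong suc (block-0 γ γ>0)
  block-suc-∈ (g ∷ [])    m _ _ () | no _ | no _
  block-suc-∈ (g ∷ h ∷ r) m (_ ∷ γ>0) m+1<Σ m+1∈ | no _ | no m≮g rewrite suc-∸ m g (≮⇒≥ m≮g) =
    cong suc (block-suc-∈ (h ∷ r) (m ∸ g) γ>0 (suc-∸-< (h ∷ r) m≮g m+1<Σ)
      (∈-partialSums-∷⁻ g h r _ (s≤s z≤n) (subst (_∈ partialSums (g ∷ h ∷ r)) (sym (+-suc-∸ m≮g)) m+1∈)))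

  block-suc-∉ : ∀ γ m → Positive γ → suc m < sum γ → suc m ∉ partialSums γ → block γ (suc m) ≡ block γ m
  block-suc-∉ [] m _ _ _ = refl
  block-suc-∉ (g ∷ γ) m _ m+1<Σ m+1∉ with suc m <? g | m <? g
  ... | yes _      | yes _  = refl
  ... | yes m+1<g  | no m≮g = contradiction (<-trans (n<1+n m) m+1<g) m≮g
  ... | no m+1≮g   | yes m<g = contradiction (g∈ γ m+1<Σ) m+1∉
    where
    g≡m+1 : g ≡ suc m
    g≡m+1 = ≤-antisym (≮⇒≥ m+1≮g) m<g
    g∈ : ∀ δ → suc m < g + sum δ → suc m ∈ partialSums (g ∷ δ)
    g∈ []      m+1<g+0 = contradiction (subst (suc m <_) (+-identityʳ g) m+1<g+0) (<-irrefl (sym g≡m+1))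
    g∈ (h ∷ r) _       = here (sym g≡m+1)
  block-suc-∉ (g ∷ [])    m _ m+1<Σ _ | no _ | no m≮g =
    contradiction (subst (suc m <_) (+-identityʳ g) m+1<Σ) (λ m+1<g → m≮g (<-trans (n<1+n m) m+1<g))
  block-suc-∉ (g ∷ h ∷ r) m (_ ∷ γ>0) m+1<Σ m+1∉ | no _ | no m≮g rewrite suc-∸ m g (≮⇒≥ m≮g) =
    cong suc (block-suc-∉ (h ∷ r) (m ∸ g) γ>0 (suc-∸-< (h ∷ r) m≮g m+1<Σ)
      (λ m∸g+1∈ → m+1∉ (subst (_∈ partialSums (g ∷ h ∷ r)) (+-suc-∸ m≮g) (∈-partialSums-∷⁺ g h r _ m∸g+1∈))))

  block-mono : ∀ γ m m′ → m ≤ m′ → block γ m ≤ block γ m′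
  block-mono []      m m′ m≤m′ = z≤n
  block-mono (g ∷ γ) m m′ m≤m′ with m <? g | m′ <? g
  ... | yes _  | _        = z≤n
  ... | no m≮g | yes m′<g = contradiction (≤-<-trans m≤m′ m′<g) m≮g
  ... | no _   | no _     = s≤s (block-mono γ (m ∸ g) (m′ ∸ g) (∸-monoˡ-≤ g m≤m′))

  block<length : ∀ γ m → m < sum γ → block γ m < length γ
  block<length (g ∷ γ) m m<Σ with m <? g
  ... | yes _  = s≤s z≤n
  ... | no m≮g = s≤s (block<length γ (m ∸ g) (∸-< γ m≮g m<Σ))

  block-start+ : ∀ γ (i : Fin (length γ)) r → r < lookup γ i → block γ (start γ (toℕ i) + r) ≡ toℕ i
  block-start+ (g ∷ γ) Fin.zero r lt with r <? g
  ... | yes _ = refl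
  ... | no a = contradiction lt a
  block-start+ (g ∷ γ) (Fin.suc i) r lt with g + start γ (toℕ i) + r <? g
  ... | yes a = contradiction (≤-trans (m≤m+n g _) (≤-reflexive (sym (+-assoc g _ r)))) (<⇒≱ a)
  ... | no a rewrite +-assoc g (start γ (toℕ i)) r | m+n∸m≡n g (start γ (toℕ i) + r) = cong suc (block-start+ γ i r lt)

  start-block≤ : ∀ γ m → m < sum γ → start γ (block γ m) ≤ m
  start-block≤ (g ∷ γ) m m<Σ with m <? g
  ... | yes _  = z≤n
  ... | no m≮g = subst (g + start γ (block γ (m ∸ g)) ≤_) (m+[n∸m]≡n (≮⇒≥ m≮g))
                   (+-monoʳ-≤ g (start-block≤ γ (m ∸ g) (∸-< γ m≮g m<Σ)))

  start+lookup≤sum : ∀ γ (i : Fin (length γ)) → start γ (toℕ i) + lookup γ i ≤ sum γ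
  start+lookup≤sum (g ∷ γ) Fin.zero = m≤m+n g (sum γ)
  start+lookup≤sum (g ∷ γ) (Fin.suc i) = subst (_≤ g + sum γ) (sym (+-assoc g _ _)) (+-monoʳ-≤ g (start+lookup≤sum γ i))

  start-suc : ∀ γ i (i<ℓ : i < length γ) → start γ (suc i) ≡ start γ i + lookup γ (fromℕ< i<ℓ)
  start-suc (g ∷ γ) zero    i<ℓ       = +-comm g 0
  start-suc (g ∷ γ) (suc i) (s≤s i<ℓ) = trans (cong (g +_) (start-suc γ i i<ℓ)) (sym (+-assoc g _ _))

  countℕ : ℕ → (ℕ → Bool) → ℕ
  countℕ zero P = 0
  countℕ (suc k) P = 𝟙 (P 0) + countℕ k (P ∘ suc)

  countℕ-+ : ∀ a b P → countℕ (a + b) P ≡ countℕ a P + countℕ b (λ m → P (a + m))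
  countℕ-+ zero b P = refl
  countℕ-+ (suc a) b P = trans (cong (𝟙 (P 0) +_) (countℕ-+ a b (P ∘ suc))) (sym (+-assoc (𝟙 (P 0)) _ _))

  countℕ-cong : ∀ k P Q → (∀ m → m < k → P m ≡ Q m) → countℕ k P ≡ countℕ k Q
  countℕ-cong zero P Q h = refl
  countℕ-cong (suc k) P Q h = cong₂ _+_ (cong 𝟙 (h 0 (s≤s z≤n))) (countℕ-cong k (P ∘ suc) (Q ∘ suc) (λ m lt → h (suc m) (s≤s lt)))

  countℕ-const : ∀ k b → countℕ k (λ _ → b) ≡ (if b then k else 0)
  countℕ-const zero false = refl
  countℕ-const zero true = refl
  countℕ-const (suc k) false = countℕ-const k false
  countℕ-const (suc k) true = cong suc (countℕ-const k true)

  count-toℕ : ∀ {n} (P : ℕ → Bool) → count {n} (λ q → P (toℕ q)) ≡ countℕ n P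
  count-toℕ {zero} P = refl
  count-toℕ {suc n} P = cong (𝟙 (P 0) +_) (count-toℕ {n} (P ∘ suc))

  countℕ-block : ∀ γ (Q : ℕ → Bool) → Positive γ →
    countℕ (sum γ) (λ m → Q (block γ m)) ≡ ∑ (λ j → if Q (toℕ j) then lookup γ j else 0) (allFin (length γ))
  countℕ-block [] Q _ = refl
  countℕ-block (g ∷ γ) Q (_ ∷ γ>0) = begin
    countℕ (g + sum γ) (λ m → Q (block (g ∷ γ) m)) ≡⟨ countℕ-+ g (sum γ) _ ⟩
    countℕ g (λ m → Q (block (g ∷ γ) m)) + countℕ (sum γ) (λ m → Q (block (g ∷ γ) (g + m)))
      ≡⟨ cong₂ _+_ (trans (countℕ-cong g _ _ first-block) (countℕ-const g (Q 0))) (countℕ-cong (sum γ) _ _ later-blocks) ⟩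
    (if Q 0 then g else 0) + countℕ (sum γ) (λ m → Q (suc (block γ m)))
      ≡⟨ cong ((if Q 0 then g else 0) +_) (countℕ-block γ (Q ∘ suc) γ>0) ⟩
    (if Q 0 then g else 0) + ∑ (λ j → if Q (suc (toℕ j)) then lookup γ j else 0) (allFin (length γ))
      ≡⟨ sym (∑-allFin-suc (λ j → if Q (toℕ j) then lookup (g ∷ γ) j else 0)) ⟩
    ∑ (λ j → if Q (toℕ j) then lookup (g ∷ γ) j else 0) (allFin (length (g ∷ γ))) ∎
    where
    open ≡-Reasoning
    first-block : ∀ m → m < g → Q (block (g ∷ γ) m) ≡ Q 0
    first-block m m<g with m <? g
    ... | yes _  = refl
    ... | no m≮g = contradiction m<g m≮g
    later-blocks : ∀ m → m < sum γ → Q (block (g ∷ γ) (g + m)) ≡ Q (suc (block γ m))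
    later-blocks m _ with g + m <? g
    ... | yes g+m<g = contradiction g+m<g (m+n≮m g m)
    ... | no _      = cong (λ t → Q (suc (block γ t))) (m+n∸m≡n g m)

  incHead : List ℕ → List ℕ
  incHead [] = []
  incHead (x ∷ xs) = suc x ∷ xs

  -- The composition of suc k whose partial sums are the x ∈ [1, k] with P x.
  cutComposition : ℕ → (ℕ → Bool) → List ℕ
  cutComposition zero P = 1 ∷ []
  cutComposition (suc k) P = if P 1 then 1 ∷ cutComposition k (P ∘ suc) else incHead (cutComposition k (P ∘ suc))

  cutComposition-nonempty : ∀ k P → ∃[ y ] ∃[ ys ] cutComposition k P ≡ y ∷ ys
  cutComposition-nonempty zero P = 1 , [] , refl
  cutComposition-nonempty (suc k) P with P 1 | cutComposition-nonempty k (P ∘ suc)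
  ... | true | y , ys , e = 1 , y ∷ ys , cong (1 ∷_) e
  ... | false | y , ys , e = suc y , ys , cong incHead e

  cutComposition-sum : ∀ k P → sum (cutComposition k P) ≡ suc k
  cutComposition-sum zero P = refl
  cutComposition-sum (suc k) P with P 1 | cutComposition-nonempty k (P ∘ suc) | cutComposition-sum k (P ∘ suc)
  ... | true | y , ys , e | s = cong suc s
  ... | false | y , ys , e | s rewrite e = cong suc s

  cutComposition-positive : ∀ k P → Positive (cutComposition k P)
  cutComposition-positive zero P = s≤s z≤n ∷ []
  cutComposition-positive (suc k) P with P 1 | cutComposition-nonempty k (P ∘ suc) | cutComposition-positive k (P ∘ suc)
  ... | true | y , ys , e | p = s≤s z≤n ∷ p
  ... | false | y , ys , e | p rewrite e with p
  ... | _ ∷ p′ = s≤s z≤n ∷ p′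

  ∈-cutComposition⁻ : ∀ k P x → x ∈ partialSums (cutComposition k P) → 1 ≤ x × x ≤ k × P x ≡ true
  ∈-cutComposition⁻ zero P x ()
  ∈-cutComposition⁻ (suc k) P x x∈ with P 1 in P1 | cutComposition k (P ∘ suc) in eq
  ... | _ | [] with y , ys , eq′ ← cutComposition-nonempty k (P ∘ suc) = contradiction (trans (sym eq) eq′) λ ()
  ∈-cutComposition⁻ (suc k) P x (here refl) | true | y ∷ ys = s≤s z≤n , s≤s z≤n , P1
  ∈-cutComposition⁻ (suc k) P x (there x∈) | true | y ∷ ys
    with x′ , x′∈ , refl ← ∈-map⁻ (1 +_) x∈
    with _ , x′≤k , Px′ ← ∈-cutComposition⁻ k (P ∘ suc) x′ (subst (λ δ → x′ ∈ partialSums δ) (sym eq) x′∈)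
    = s≤s z≤n , s≤s x′≤k , Px′
  ∈-cutComposition⁻ (suc k) P x x∈ | false | y ∷ ys
    with x′ , x′∈ , refl ← ∈-map⁻ (1 +_) (subst (x ∈_) (partialSums-+head 1 y ys) x∈)
    with _ , x′≤k , Px′ ← ∈-cutComposition⁻ k (P ∘ suc) x′ (subst (λ δ → x′ ∈ partialSums δ) (sym eq) x′∈)
    = s≤s z≤n , s≤s x′≤k , Px′

  ∈-cutComposition⁺ : ∀ k P x → 1 ≤ x → x ≤ k → P x ≡ true → x ∈ partialSums (cutComposition k P)
  ∈-cutComposition⁺ (suc k) P (suc x) _ x≤k Px with P 1 in P1 | cutComposition-nonempty k (P ∘ suc)
  ∈-cutComposition⁺ (suc k) P 1             _ _         Px | true  | y , ys , eq rewrite eq = here refl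
  ∈-cutComposition⁺ (suc k) P 1             _ _         Px | false | _ = contradiction (trans (sym Px) P1) λ ()
  ∈-cutComposition⁺ (suc k) P (suc (suc x)) _ (s≤s x≤k) Px | true  | y , ys , eq rewrite eq =
    there (∈-map⁺ (1 +_) (subst (λ δ → suc x ∈ partialSums δ) eq (∈-cutComposition⁺ k (P ∘ suc) (suc x) (s≤s z≤n) x≤k Px)))
  ∈-cutComposition⁺ (suc k) P (suc (suc x)) _ (s≤s x≤k) Px | false | y , ys , eq rewrite eq =
    subst (suc (suc x) ∈_) (sym (partialSums-+head 1 y ys))
      (∈-map⁺ (1 +_) (subst (λ δ → suc x ∈ partialSums δ) eq (∈-cutComposition⁺ k (P ∘ suc) (suc x) (s≤s z≤n) x≤k Px)))

  -- A refinement whose first block is nonempty, so that incrementing the heads of both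
  -- compositions again gives a refinement.
  record Refines⁺ (γ β : List ℕ) : Set where
    constructor refines⁺
    field
      first  : ℕ
      firsts : List ℕ
      blocks : List (List ℕ)
      concat≡ : concat ((first ∷ firsts) ∷ blocks) ≡ γ
      sums≡   : map sum ((first ∷ firsts) ∷ blocks) ≡ β

  Refines⁺⇒Refines : ∀ {γ β} → Refines⁺ γ β → Refines γ β
  Refines⁺⇒Refines (refines⁺ x xs L concat≡ sums≡) = (x ∷ xs) ∷ L , concat≡ , sums≡

  cutComposition-refines : ∀ k (R Q : ℕ → Bool) → (∀ x → Q x ≡ true → R x ≡ true) →
                           Refines⁺ (cutComposition k R) (cutComposition k Q)
  cutComposition-refines zero    R Q Q⇒R = refines⁺ 1 [] [] refl refl
  cutComposition-refines (suc k) R Q Q⇒R with R 1 in R1 | Q 1 in Q1 | cutComposition-refines k (R ∘ suc) (Q ∘ suc) (Q⇒R ∘ suc)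
  ... | true  | true  | refines⁺ x xs L concat≡ sums≡ = refines⁺ 1 [] ((x ∷ xs) ∷ L) (cong (1 ∷_) concat≡) (cong (1 ∷_) sums≡)
  ... | true  | false | refines⁺ x xs L concat≡ sums≡ = refines⁺ 1 (x ∷ xs) L (cong (1 ∷_) concat≡) (cong incHead sums≡)
  ... | false | false | refines⁺ x xs L concat≡ sums≡ = refines⁺ (suc x) xs L (cong incHead concat≡) (cong incHead sums≡)
  ... | false | true  | _ = contradiction (trans (sym (Q⇒R 1 Q1)) R1) λ ()

  partialSums-injective : ∀ γ δ → Positive γ → Positive δ → sum γ ≡ sum δ →
                          (∀ x → x ∈ partialSums γ → x ∈ partialSums δ) →
                          (∀ x → x ∈ partialSums δ → x ∈ partialSums γ) → γ ≡ δ
  partialSums-injective [] [] _ _ _ _ _ = refl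
  partialSums-injective [] (d ∷ δ) _ (d>0 ∷ _) Σ≡ _ _ = contradiction Σ≡ (<⇒≢ (<-≤-trans d>0 (m≤m+n d (sum δ))))
  partialSums-injective (g ∷ γ) [] (g>0 ∷ _) _ Σ≡ _ _ = contradiction (sym Σ≡) (<⇒≢ (<-≤-trans g>0 (m≤m+n g (sum γ))))
  partialSums-injective (g ∷ []) (d ∷ []) _ _ Σ≡ _ _ = cong (_∷ []) (trans (sym (+-identityʳ g)) (trans Σ≡ (+-identityʳ d)))
  partialSums-injective (g ∷ []) (d ∷ h ∷ r) _ _ _ _ δ⊆γ with () ← δ⊆γ d (here refl)
  partialSums-injective (g ∷ h ∷ r) (d ∷ []) _ _ _ γ⊆δ _ with () ← γ⊆δ g (here refl)
  partialSums-injective (g ∷ h ∷ r) (d ∷ h′ ∷ r′) (_ ∷ γ>0) (_ ∷ δ>0) Σ≡ γ⊆δ δ⊆γ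
    with refl ← ≤-antisym (∈-partialSums⇒head≤ g (h ∷ r) d (δ⊆γ d (here refl)))
                          (∈-partialSums⇒head≤ d (h′ ∷ r′) g (γ⊆δ g (here refl)))
    = cong (g ∷_) (partialSums-injective (h ∷ r) (h′ ∷ r′) γ>0 δ>0 (+-cancelˡ-≡ g _ _ Σ≡)
        (λ x x∈ → ∈-partialSums-∷⁻ g h′ r′ x (∈-partialSums⇒positive (h ∷ r) x γ>0 x∈)
                                              (γ⊆δ (g + x) (∈-partialSums-∷⁺ g h r x x∈)))
        (λ x x∈ → ∈-partialSums-∷⁻ g h r x (∈-partialSums⇒positive (h′ ∷ r′) x δ>0 x∈)
                                            (δ⊆γ (g + x) (∈-partialSums-∷⁺ g h′ r′ x x∈))))

  cutComposition-partialSums : ∀ {m} γ → IsComposition m γ → 1 ≤ m →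
                               cutComposition (m ∸ 1) (λ x → does (x ∈? partialSums γ)) ≡ γ
  cutComposition-partialSums {m} γ (γ>0 , γ-sum) 1≤m = partialSums-injective _ γ (cutComposition-positive (m ∸ 1) _) γ>0
      (trans (cutComposition-sum (m ∸ 1) _) (trans suc-pred-m (sym γ-sum)))
      (λ x x∈ → let (_ , _ , x∈γ) = ∈-cutComposition⁻ (m ∸ 1) _ x x∈ in true⇒witness (x ∈? partialSums γ) x∈γ)
      (λ x x∈γ → ∈-cutComposition⁺ (m ∸ 1) _ x (∈-partialSums⇒positive γ x γ>0 x∈γ)
                   (≤-pred (subst (suc x ≤_) (trans γ-sum (sym suc-pred-m)) (∈-partialSums⇒<sum γ x γ>0 x∈γ)))
                   (dec-true (x ∈? partialSums γ) x∈γ))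
    where
    suc-pred-m : suc (m ∸ 1) ≡ m
    suc-pred-m = trans (sym (+-∸-assoc 1 1≤m)) (m+n∸m≡n 1 m)

  Positive-lookup : ∀ γ → Positive γ → ∀ j → 0 < lookup γ j
  Positive-lookup (g ∷ γ) (pg ∷ _) Fin.zero = pg
  Positive-lookup (g ∷ γ) (_ ∷ pγ) (Fin.suc j) = Positive-lookup γ pγ j

  Adjacent : ∀ {n} → Fin n → Fin n → Set
  Adjacent a b = toℕ b ≡ suc (toℕ a)

  Adjacent? : ∀ {n} (a b : Fin n) → Dec (Adjacent a b)
  Adjacent? a b = toℕ b ≟ suc (toℕ a)

  Adjacent⇒< : ∀ {n} {a b : Fin n} → Adjacent a b → a Fin.< b
  Adjacent⇒< {a = a} adj = subst (toℕ a <_) (sym adj) (n<1+n _)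

  DesSubset⇒ascent : ∀ {n} γ {w : Fun n} → IsPerm w → DesSubset γ w →
                     ∀ {a b} → Adjacent a b → suc (toℕ a) ∉ partialSums γ → w a Fin.< w b
  DesSubset⇒ascent γ {w} w-inj des {a} {b} adj a+1∉γ with Finₚ.<-cmp (w a) (w b)
  ... | tri< wa<wb _ _ = wa<wb
  ... | tri≈ _ wa≡wb _ = contradiction (w-inj a b wa≡wb) (Finₚ.<⇒≢ (Adjacent⇒< adj))
  ... | tri> _ _ wb<wa = contradiction (des a b adj wb<wa) a+1∉γ

  module Blocks {n : ℕ} (γ : List ℕ) (γ-pos : Positive γ) (γ-sum : sum γ ≡ n) where

    ℓ : ℕ
    ℓ = length γ

    toℕ<sum : ∀ (q : Fin n) → toℕ q < sum γ
    toℕ<sum q = subst (toℕ q <_) (sym γ-sum) (Finₚ.toℕ<n q)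

    blockOf : Fin n → Fin ℓ
    blockOf q = fromℕ< (block<length γ (toℕ q) (toℕ<sum q))

    toℕ-blockOf : ∀ q → toℕ (blockOf q) ≡ block γ (toℕ q)
    toℕ-blockOf q = Finₚ.toℕ-fromℕ< (block<length γ (toℕ q) (toℕ<sum q))

    adjacent⇒suc<sum : ∀ {a b : Fin n} → Adjacent a b → suc (toℕ a) < sum γ
    adjacent⇒suc<sum {a} {b} e = subst (_< sum γ) e (toℕ<sum b)

    adjacent-∉⇒sameBlock : ∀ {a b : Fin n} → Adjacent a b → suc (toℕ a) ∉ partialSums γ → block γ (toℕ a) ≡ block γ (toℕ b)
    adjacent-∉⇒sameBlock {a} {b} e nm = trans (sym (block-suc-∉ γ (toℕ a) γ-pos (adjacent⇒suc<sum e) nm)) (cong (block γ) (sym e))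

    sameBlock⇒∉partialSums : ∀ (a a′ : Fin n) x → toℕ a ≤ x → suc x ≤ toℕ a′ →
                             block γ (toℕ a) ≡ block γ (toℕ a′) → suc x ∉ partialSums γ
    sameBlock⇒∉partialSums a a′ x a≤x x<a′ same x+1∈γ = <-irrefl same (begin-strict
        block γ (toℕ a)  ≤⟨ block-mono γ _ _ a≤x ⟩
        block γ x        <⟨ ≤-reflexive (sym (block-suc-∈ γ x γ-pos (<-≤-trans (s≤s x<a′) (toℕ<sum a′)) x+1∈γ)) ⟩
        block γ (suc x)  ≤⟨ block-mono γ _ _ x<a′ ⟩
        block γ (toℕ a′) ∎)
      where open ≤-Reasoning

    module SameBlock (R : Fin n → Fin n → Set) (R-trans : ∀ {x y z} → R x y → R y z → R x z)
                     (R-step : ∀ x y → Adjacent x y → suc (toℕ x) ∉ partialSums γ → R x y) where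

      sameBlock⇒R : ∀ (a a′ : Fin n) → toℕ a < toℕ a′ → block γ (toℕ a) ≡ block γ (toℕ a′) → R a a′
      sameBlock⇒R a a′ a<a′ = chain (toℕ a′ ∸ suc (toℕ a)) a′ (sym (trans (sym (+-suc _ (toℕ a))) (m∸n+n≡m a<a′)))
        where
        chain : ∀ d a′ → toℕ a′ ≡ suc (d + toℕ a) → block γ (toℕ a) ≡ block γ (toℕ a′) → R a a′
        chain zero    a′ adj same = R-step a a′ adj (sameBlock⇒∉partialSums a a′ (toℕ a) ≤-refl (≤-reflexive (sym adj)) same)
        chain (suc d) a′ a′≡ same =
          R-trans (chain d mid mid≡ same-mid)
                  (R-step mid a′ adj (sameBlock⇒∉partialSums mid a′ (toℕ mid) ≤-refl (≤-reflexive (sym adj)) (trans (sym same-mid) same)))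
          where
          mid<n : suc (d + toℕ a) < n
          mid<n = <-trans (subst (suc (d + toℕ a) <_) (sym a′≡) (n<1+n _)) (Finₚ.toℕ<n a′)
          mid : Fin n
          mid = fromℕ< mid<n
          mid≡ : toℕ mid ≡ suc (d + toℕ a)
          mid≡ = Finₚ.toℕ-fromℕ< mid<n
          adj : toℕ a′ ≡ suc (toℕ mid)
          adj = trans a′≡ (cong suc (sym mid≡))
          same-mid : block γ (toℕ a) ≡ block γ (toℕ mid)
          same-mid = ≤-antisym (block-mono γ _ _ (subst (toℕ a ≤_) (sym mid≡) (≤-trans (m≤n+m (toℕ a) d) (n≤1+n _))))
                               (subst (block γ (toℕ mid) ≤_) (sym same) (block-mono γ _ _ (subst (toℕ mid ≤_) (sym adj) (n≤1+n _))))

    count-blockOf : (H : Fin ℓ → Bool) → count (λ q → H (blockOf q)) ≡ ∑ (λ i → if H i then lookup γ i else 0) (allFin ℓ)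
    count-blockOf H = begin
      count (λ q → H (blockOf q))                            ≡⟨ count-cong blockOf-via-ℕ ⟩
      count {n} (λ q → Hℕ (block γ (toℕ q)))                 ≡⟨ count-toℕ {n} (λ m → Hℕ (block γ m)) ⟩
      countℕ n (λ m → Hℕ (block γ m))                        ≡⟨ cong (λ t → countℕ t (λ m → Hℕ (block γ m))) γ-sum ⟨
      countℕ (sum γ) (λ m → Hℕ (block γ m))                  ≡⟨ countℕ-block γ Hℕ γ-pos ⟩
      ∑ (λ i → if Hℕ (toℕ i) then lookup γ i else 0) (allFin ℓ)
        ≡⟨ ∑-cong (allFin ℓ) (λ i → cong (λ t → if t then lookup γ i else 0) (Hℕ-toℕ i)) ⟩
      ∑ (λ i → if H i then lookup γ i else 0) (allFin ℓ)      ∎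
      where
      open ≡-Reasoning
      Hℕ : ℕ → Bool
      Hℕ m with m <? ℓ
      ... | yes m<ℓ = H (fromℕ< m<ℓ)
      ... | no _    = false
      blockOf-via-ℕ : ∀ q → H (blockOf q) ≡ Hℕ (block γ (toℕ q))
      blockOf-via-ℕ q with block γ (toℕ q) <? ℓ
      ... | yes b<ℓ = cong H (Finₚ.fromℕ<-cong _ _ refl _ b<ℓ)
      ... | no b≮ℓ  = contradiction (block<length γ (toℕ q) (toℕ<sum q)) b≮ℓ
      Hℕ-toℕ : ∀ i → Hℕ (toℕ i) ≡ H i
      Hℕ-toℕ i with toℕ i <? ℓ
      ... | yes i<ℓ = cong H (Finₚ.fromℕ<-toℕ i i<ℓ)
      ... | no i≮ℓ  = contradiction (Finₚ.toℕ<n i) i≮ℓ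

    start<n : ∀ j → start γ (toℕ j) < n
    start<n j = subst (start γ (toℕ j) <_) γ-sum
               (<-≤-trans (subst (_< start γ (toℕ j) + lookup γ j) (+-identityʳ _) (+-monoʳ-< (start γ (toℕ j)) (Positive-lookup γ γ-pos j)))
                             (start+lookup≤sum γ j))

    startOf : Fin ℓ → Fin n
    startOf j = fromℕ< (start<n j)

    toℕ-startOf : ∀ j → toℕ (startOf j) ≡ start γ (toℕ j)
    toℕ-startOf j = Finₚ.toℕ-fromℕ< (start<n j)

    block-startOf : ∀ j → block γ (toℕ (startOf j)) ≡ toℕ j
    block-startOf j = trans (cong (block γ) (trans (toℕ-startOf j) (sym (+-identityʳ _)))) (block-start+ γ j 0 (Positive-lookup γ γ-pos j))

    blockOf-startOf : ∀ j → blockOf (startOf j) ≡ j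
    blockOf-startOf j = Finₚ.toℕ-injective (trans (toℕ-blockOf (startOf j)) (block-startOf j))

    startOf-blockOf≤ : ∀ q → toℕ (startOf (blockOf q)) ≤ toℕ q
    startOf-blockOf≤ q = subst (_≤ toℕ q) (sym (trans (toℕ-startOf (blockOf q)) (cong (start γ) (toℕ-blockOf q))))
                               (start-block≤ γ (toℕ q) (toℕ<sum q))

    block-startOf-blockOf : ∀ q → block γ (toℕ (startOf (blockOf q))) ≡ block γ (toℕ q)
    block-startOf-blockOf q = trans (block-startOf (blockOf q)) (toℕ-blockOf q)

  -- Descent classes and their products

  descentClass : ∀ n → List ℕ → List (Fun n)
  descentClass n γ = filter (desSubset? γ) (permutations n)

  descentClass-IsPerm : ∀ n γ → All IsPerm (descentClass n γ)
  descentClass-IsPerm n γ = Allₚ.filter⁺ (desSubset? γ) (Allₚ.all-filter isPerm? (allFuns n n))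

  #-descentClass : ∀ {n e} γ (q : Fun n) {E : Fun n → Set e} (E? : ∀ u → Dec (E u)) → (∀ u → E u ⇔ u ≗ q) →
                   # E? (descentClass n γ) ≡ when (isPerm? q ×-dec desSubset? γ q) 1
  #-descentClass {n} γ q {E} E? E⇔ = begin
    # E? (filter (desSubset? γ) (filter isPerm? (allFuns n n)))
      ≡⟨ trans (#-filter (desSubset? γ) E? (filter isPerm? (allFuns n n)))
               (#-filter isPerm? (λ u → desSubset? γ u ×-dec E? u) (allFuns n n)) ⟩
    # (λ u → isPerm? u ×-dec desSubset? γ u ×-dec E? u) (allFuns n n)
      ≡⟨ ∑-cong (allFuns n n) (λ u → trans (when-cong (isPerm? u ×-dec desSubset? γ u ×-dec E? u)
                                                      (u ≗? q ×-dec isPerm? u ×-dec desSubset? γ u) (reorder u) refl)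
                                           (when-×-dec (u ≗? q) (isPerm? u ×-dec desSubset? γ u))) ⟩
    ∑ (λ u → when (u ≗? q) (when (isPerm? u ×-dec desSubset? γ u) 1)) (allFuns n n)
      ≡⟨ ∑-allFuns-δ n n q (λ u → when (isPerm? u ×-dec desSubset? γ u) 1) class-resp ⟩
    when (isPerm? q ×-dec desSubset? γ q) 1 ∎
    where
    open ≡-Reasoning
    reorder : ∀ u → (IsPerm u × DesSubset γ u × E u) ⇔ (u ≗ q × IsPerm u × DesSubset γ u)
    reorder u = mk⇔ (λ (perm , des , e) → Equivalence.to (E⇔ u) e , perm , des)
                    (λ (u≗q , perm , des) → perm , des , Equivalence.from (E⇔ u) u≗q)
    class-resp : ∀ {f f′} → f ≗ f′ → when (isPerm? f ×-dec desSubset? γ f) 1 ≡ when (isPerm? f′ ×-dec desSubset? γ f′) 1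
    class-resp {f} {f′} f≗f′ = when-cong (isPerm? f ×-dec desSubset? γ f) (isPerm? f′ ×-dec desSubset? γ f′)
      (mk⇔ (λ (perm , des) → IsPerm-resp f≗f′ perm , DesSubset-resp γ f≗f′ des)
           (λ (perm , des) → IsPerm-resp (sym ∘ f≗f′) perm , DesSubset-resp γ (sym ∘ f≗f′) des)) refl

  module Mackey {n : ℕ} (α β : List ℕ) (α-comp : IsComposition n α) (β-comp : IsComposition n β) where

    module Bα = Blocks α (proj₁ α-comp) (proj₂ α-comp)
    module Bβ = Blocks β (proj₁ β-comp) (proj₂ β-comp)

    Labelling : Set
    Labelling = Fin n → Fin (length α)

    WithinBlocks : ∀ {r} → (Fin n → Fin n → Set r) → Set r
    WithinBlocks R = ∀ a b → Adjacent a b → suc (toℕ a) ∉ partialSums β → R a b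

    withinBlocks? : ∀ {r} {R : Fin n → Fin n → Set r} → (∀ a b → Dec (R a b)) → Dec (WithinBlocks R)
    withinBlocks? R? = Finₚ.all? λ a → Finₚ.all? λ b →
      Adjacent? a b →-dec ¬? (suc (toℕ a) ∈? partialSums β) →-dec R? a b

    HasContent : Labelling → Set
    HasContent c = ∀ i → count (λ q → does (c q Fin.≟ i)) ≡ lookup α i

    hasContent? : ∀ c → Dec (HasContent c)
    hasContent? c = Finₚ.all? λ i → count (λ q → does (c q Fin.≟ i)) ≟ lookup α i

    HasContent-resp : Respects≗ HasContent
    HasContent-resp c≗c′ content i = trans (count-cong λ q → cong (λ x → does (x Fin.≟ i)) (sym (c≗c′ q))) (content i)

    WeaklyIncreasing BlockConstant : Labelling → Set
    WeaklyIncreasing c = WithinBlocks (λ a b → c a Fin.≤ c b)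
    BlockConstant    c = WithinBlocks (λ a b → c a ≡ c b)

    weaklyIncreasing? : ∀ c → Dec (WeaklyIncreasing c)
    weaklyIncreasing? c = withinBlocks? λ a b → c a Fin.≤? c b

    blockConstant? : ∀ c → Dec (BlockConstant c)
    blockConstant? c = withinBlocks? λ a b → c a Fin.≟ c b

    BlockConstant-resp : Respects≗ BlockConstant
    BlockConstant-resp c≗c′ const a b adj a+1∉β = trans (sym (c≗c′ a)) (trans (const a b adj a+1∉β) (c≗c′ b))

    count-labels-below : ∀ {c} → HasContent c → ∀ i → i ≤ length α → count (λ r → does (toℕ (c r) <? i)) ≡ start α i
    count-labels-below {c} content zero    _   = count-false λ r → dec-false (toℕ (c r) <? 0) λ ()
    count-labels-below {c} content (suc i) i<ℓ = begin
      count (λ r → does (toℕ (c r) <? suc i))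
        ≡⟨ count-cong (λ r → does-⇔ (mk⇔ m<1+n⇒m<n∨m≡n [ m<n⇒m<1+n , ≤-reflexive ∘ cong suc ]) (toℕ (c r) <? suc i) (below r ⊎-dec at r)) ⟩
      count (λ r → does (below r ⊎-dec at r))
        ≡⟨ count-⊎ below at (λ r r<i r≡i → <-irrefl r≡i r<i) ⟩
      count (does ∘ below) + count (does ∘ at)
        ≡⟨ cong₂ _+_ (count-labels-below content i (<⇒≤ i<ℓ)) (trans (count-cong at⇔) (content (fromℕ< i<ℓ))) ⟩
      start α i + lookup α (fromℕ< i<ℓ)
        ≡⟨ start-suc α i i<ℓ ⟨
      start α (suc i) ∎
      where
      open ≡-Reasoning
      below at : ∀ r → Dec _
      below r = toℕ (c r) <? i
      at    r = toℕ (c r) ≟ i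
      at⇔ : ∀ r → does (at r) ≡ does (c r Fin.≟ fromℕ< i<ℓ)
      at⇔ r = does-⇔ (mk⇔ (λ cr≡i → Finₚ.toℕ-injective (trans cr≡i (sym (Finₚ.toℕ-fromℕ< i<ℓ))))
                          (λ cr≡ → trans (cong toℕ cr≡) (Finₚ.toℕ-fromℕ< i<ℓ))) (at r) (c r Fin.≟ fromℕ< i<ℓ)

    ascending-within-α-blocks : ∀ {s} → IsPerm s → DesSubset α s →
                                ∀ {a a′} → toℕ a < toℕ a′ → block α (toℕ a) ≡ block α (toℕ a′) → s a Fin.< s a′
    ascending-within-α-blocks {s} s-inj des {a} {a′} =
      Bα.SameBlock.sameBlock⇒R (λ x y → s x Fin.< s y) <-trans
        (λ x y adj x+1∉α → DesSubset⇒ascent α s-inj des adj x+1∉α) a a′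

    blockOf-reflects-< : ∀ {x y} → Bα.blockOf x Fin.< Bα.blockOf y → x Fin.< y
    blockOf-reflects-< {x} {y} bx<by with Finₚ.<-cmp x y
    ... | tri< x<y _ _ = x<y
    ... | tri≈ _ refl _ = contradiction bx<by (<-irrefl refl)
    ... | tri> _ _ y<x = contradiction (subst₂ _<_ (Bα.toℕ-blockOf x) (Bα.toℕ-blockOf y) bx<by)
                                       (≤⇒≯ (block-mono α _ _ (<⇒≤ y<x)))

    blockOf≡⇒sameBlock : ∀ {x y} → Bα.blockOf x ≡ Bα.blockOf y → block α (toℕ x) ≡ block α (toℕ y)
    blockOf≡⇒sameBlock {x} {y} eq = trans (sym (Bα.toℕ-blockOf x)) (trans (cong toℕ eq) (Bα.toℕ-blockOf y))

    FibreSums : (Fin (length β) → Fin (length α)) → Set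
    FibreSums f = ∀ j → lookup α j ≡ fiberSum α β f j

    fibreSums? : ∀ f → Dec (FibreSums f)
    fibreSums? f = Finₚ.all? λ j → lookup α j ≟ fiberSum α β f j

    FibreSums-resp : Respects≗ FibreSums
    FibreSums-resp f≗f′ sums j =
      trans (sums j) (cong sum (Listₚ.map-cong (λ i → cong (λ x → if does (x Fin.≟ j) then lookup β i else 0) (f≗f′ i)) (allFin _)))

    fiberSum≡∑ : ∀ f j → fiberSum α β f j ≡ ∑ (λ i → when (f i Fin.≟ j) (lookup β i)) (allFin (length β))
    fiberSum≡∑ f j = sum-map≡∑ (λ i → when (f i Fin.≟ j) (lookup β i)) (allFin (length β))

    ContentConstant : Labelling → Set
    ContentConstant c = HasContent c × BlockConstant c

    contentConstant? : ∀ c → Dec (ContentConstant c)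
    contentConstant? c = hasContent? c ×-dec blockConstant? c

    constant-on-blocks : ∀ {c} → BlockConstant c → ∀ q → c (Bβ.startOf (Bβ.blockOf q)) ≡ c q
    constant-on-blocks {c} const q with m≤n⇒m<n∨m≡n (Bβ.startOf-blockOf≤ q)
    ... | inj₂ same = cong c (Finₚ.toℕ-injective same)
    ... | inj₁ before = Bβ.SameBlock.sameBlock⇒R (λ x y → c x ≡ c y) trans const _ q before (Bβ.block-startOf-blockOf q)

    blockwise↔fibreSums : Correspondence ContentConstant FibreSums
    blockwise↔fibreSums = record
      { to        = λ c → c ∘ Bβ.startOf
      ; from      = λ f → f ∘ Bβ.blockOf
      ; to-cong   = λ c≗c′ → c≗c′ ∘ Bβ.startOf
      ; from-cong = λ f≗f′ → f≗f′ ∘ Bβ.blockOf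
      ; to-∈      = λ {c} (content , const) j → begin
          lookup α j                                                   ≡⟨ content j ⟨
          count (λ q → does (c q Fin.≟ j))                             ≡⟨ count-cong (λ q → cong (λ x → does (x Fin.≟ j)) (constant-on-blocks const q)) ⟨
          count (λ q → does (c (Bβ.startOf (Bβ.blockOf q)) Fin.≟ j))   ≡⟨ Bβ.count-blockOf (λ i → does (c (Bβ.startOf i) Fin.≟ j)) ⟩
          ∑ (λ i → when (c (Bβ.startOf i) Fin.≟ j) (lookup β i)) (allFin (length β)) ≡⟨ fiberSum≡∑ (c ∘ Bβ.startOf) j ⟨
          fiberSum α β (c ∘ Bβ.startOf) j                              ∎
      ; from-∈    = λ {f} sums → (λ i → trans (Bβ.count-blockOf (λ j → does (f j Fin.≟ i)))
                                              (trans (sym (fiberSum≡∑ f i)) (sym (sums i))))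
                                , λ a b adj a+1∉β → cong f (Finₚ.toℕ-injective
                                    (trans (Bβ.toℕ-blockOf a) (trans (Bβ.adjacent-∉⇒sameBlock adj a+1∉β) (sym (Bβ.toℕ-blockOf b)))))
      ; from∘to   = λ (_ , const) → constant-on-blocks const
      ; to∘from   = λ {f} _ j → cong f (Bβ.blockOf-startOf j)
      }
      where open ≡-Reasoning

    #contentConstant≡η : # contentConstant? (allFuns n (length α)) ≡ η β α
    #contentConstant≡η = begin
      # contentConstant? (allFuns n (length α))
        ≡⟨ #-correspondence contentConstant? fibreSums?
             (λ c≗c′ (content , const) → HasContent-resp c≗c′ content , BlockConstant-resp c≗c′ const)
             FibreSums-resp blockwise↔fibreSums ⟩
      # fibreSums? (allFuns (length β) (length α))           ≡⟨ length-filter≡# fibreSums? (allFuns (length β) (length α)) ⟨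
      η β α                                                  ∎
      where open ≡-Reasoning

    ChangesAt : Labelling → ℕ → Set
    ChangesAt c x = ∃[ a ] ∃[ b ] Adjacent a b × toℕ b ≡ x × c a ≢ c b

    changesAt? : ∀ c x → Dec (ChangesAt c x)
    changesAt? c x = Finₚ.any? λ a → Finₚ.any? λ b → Adjacent? a b ×-dec toℕ b ≟ x ×-dec ¬? (c a Fin.≟ c b)

    refinedCut? : ∀ c x → Dec (x ∈ partialSums β ⊎ ChangesAt c x)
    refinedCut? c x = (x ∈? partialSums β) ⊎-dec changesAt? c x

    γ : Labelling → List ℕ
    γ c = cutComposition (n ∸ 1) (does ∘ refinedCut? c)

    Adjacent⇒suc≤n∸1 : ∀ {a b : Fin n} → Adjacent a b → suc (toℕ a) ≤ n ∸ 1
    Adjacent⇒suc≤n∸1 {a} {b} adj = subst₂ _≤_ adj (pred[m∸n]≡m∸[1+n] n 0) (suc[m]≤n⇒m≤pred[n] (Finₚ.toℕ<n b))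

    ∈-γ⁺ : ∀ c {a b} → Adjacent a b → suc (toℕ a) ∈ partialSums β ⊎ c a ≢ c b → suc (toℕ a) ∈ partialSums (γ c)
    ∈-γ⁺ c {a} {b} adj cut = ∈-cutComposition⁺ (n ∸ 1) _ (suc (toℕ a)) (s≤s z≤n) (Adjacent⇒suc≤n∸1 adj)
      (dec-true (refinedCut? c (suc (toℕ a))) ([ inj₁ , (λ ca≢cb → inj₂ (a , b , adj , adj , ca≢cb)) ] cut))

    ∈-γ⁻ : ∀ c {a b} → Adjacent a b → suc (toℕ a) ∈ partialSums (γ c) → suc (toℕ a) ∈ partialSums β ⊎ c a ≢ c b
    ∈-γ⁻ c {a} {b} adj a+1∈γ with (_ , _ , cut) ← ∈-cutComposition⁻ (n ∸ 1) _ (suc (toℕ a)) a+1∈γ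
                              with true⇒witness (refinedCut? c (suc (toℕ a))) cut
    ... | inj₁ a+1∈β = inj₁ a+1∈β
    ... | inj₂ (a′ , b′ , adj′ , b′≡a+1 , ca′≢cb′) =
      inj₂ λ ca≡cb → ca′≢cb′ (trans (cong c a′≡a) (trans ca≡cb (cong c (sym b′≡b))))
      where
      b′≡b : b′ ≡ b
      b′≡b = Finₚ.toℕ-injective (trans b′≡a+1 (sym adj))
      a′≡a : a′ ≡ a
      a′≡a = Finₚ.toℕ-injective (suc-injective (trans (sym adj′) (trans (cong toℕ b′≡b) adj)))

    ¬BlockConstant⇒1≤n : ∀ {c} → ¬ BlockConstant c → 1 ≤ n
    ¬BlockConstant⇒1≤n ¬const with 1 ≤? n
    ... | yes 1≤n = 1≤n
    ... | no 1≰n  = contradiction (λ a _ _ _ → ⊥-elim (1≰n (≤-trans (s≤s z≤n) (Finₚ.toℕ<n a)))) ¬const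

    γ-IsComposition : ∀ {c} → ¬ BlockConstant c → IsComposition n (γ c)
    γ-IsComposition ¬const = cutComposition-positive (n ∸ 1) _ ,
      trans (cutComposition-sum (n ∸ 1) _) (trans (sym (+-∸-assoc 1 (¬BlockConstant⇒1≤n ¬const))) (m+n∸m≡n 1 n))

    γ-strictlyRefines : ∀ {c} → ¬ BlockConstant c → StrictlyRefines (γ c) β
    γ-strictlyRefines {c} ¬const = subst (Refines (γ c)) (cutComposition-partialSums β β-comp (¬BlockConstant⇒1≤n ¬const))
        (Refines⁺⇒Refines (cutComposition-refines (n ∸ 1) _ _
          λ x x∈β → dec-true (refinedCut? c x) (inj₁ (true⇒witness (x ∈? partialSums β) x∈β))))
      , λ γc≡β → ¬const λ a b adj a+1∉β → case c a Fin.≟ c b of λ where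
          (yes ca≡cb) → ca≡cb
          (no ca≢cb)  → contradiction (subst (λ δ → suc (toℕ a) ∈ partialSums δ) γc≡β (∈-γ⁺ c adj (inj₂ ca≢cb))) a+1∉β

    Refining : Labelling → Set
    Refining c = (HasContent c × WeaklyIncreasing c) × ¬ BlockConstant c

    refining? : ∀ c → Dec (Refining c)
    refining? c = (hasContent? c ×-dec weaklyIncreasing? c) ×-dec ¬? (blockConstant? c)

    refiningLabellings : List Labelling
    refiningLabellings = filter refining? (allFuns n (length α))

    module Factorisations (p : Fun n) (p-inj : IsPerm p) where

      _≺⟨_⟩_ : Fin n → Labelling → Fin n → Set
      a ≺⟨ c ⟩ b = c a Fin.< c b ⊎ (c a ≡ c b × p a Fin.< p b)

      ≺? : ∀ c a b → Dec (a ≺⟨ c ⟩ b)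
      ≺? c a b = (c a Fin.<? c b) ⊎-dec ((c a Fin.≟ c b) ×-dec (p a Fin.<? p b))

      ≺-irrefl : ∀ c a → ¬ a ≺⟨ c ⟩ a
      ≺-irrefl c a (inj₁ ca<ca)       = <-irrefl refl ca<ca
      ≺-irrefl c a (inj₂ (_ , pa<pa)) = <-irrefl refl pa<pa

      ≺-trans : ∀ c {a b d} → a ≺⟨ c ⟩ b → b ≺⟨ c ⟩ d → a ≺⟨ c ⟩ d
      ≺-trans c (inj₁ ca<cb)         (inj₁ cb<cd)         = inj₁ (<-trans ca<cb cb<cd)
      ≺-trans c (inj₁ ca<cb)         (inj₂ (cb≡cd , _))   = inj₁ (subst (c _ Fin.<_) cb≡cd ca<cb)
      ≺-trans c (inj₂ (ca≡cb , _))   (inj₁ cb<cd)         = inj₁ (subst (Fin._< c _) (sym ca≡cb) cb<cd)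
      ≺-trans c (inj₂ (ca≡cb , pa<pb)) (inj₂ (cb≡cd , pb<pd)) = inj₂ (trans ca≡cb cb≡cd , <-trans pa<pb pb<pd)

      ≺-connex : ∀ c {a b} → a ≢ b → a ≺⟨ c ⟩ b ⊎ b ≺⟨ c ⟩ a
      ≺-connex c {a} {b} a≢b with Finₚ.<-cmp (c a) (c b) | Finₚ.<-cmp (p a) (p b)
      ... | tri< ca<cb _ _ | _              = inj₁ (inj₁ ca<cb)
      ... | tri> _ _ cb<ca | _              = inj₂ (inj₁ cb<ca)
      ... | tri≈ _ ca≡cb _ | tri< pa<pb _ _ = inj₁ (inj₂ (ca≡cb , pa<pb))
      ... | tri≈ _ ca≡cb _ | tri> _ _ pb<pa = inj₂ (inj₂ (sym ca≡cb , pb<pa))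
      ... | tri≈ _ _ _     | tri≈ _ pa≡pb _ = contradiction (p-inj a b pa≡pb) a≢b

      ≺-resp : ∀ {c c′} → c ≗ c′ → ∀ {a b} → a ≺⟨ c ⟩ b → a ≺⟨ c′ ⟩ b
      ≺-resp c≗c′ {a} {b} (inj₁ ca<cb)         = inj₁ (subst₂ Fin._<_ (c≗c′ a) (c≗c′ b) ca<cb)
      ≺-resp c≗c′ {a} {b} (inj₂ (ca≡cb , pa<pb)) = inj₂ (trans (sym (c≗c′ a)) (trans ca≡cb (c≗c′ b)) , pa<pb)

      module Rankᶜ (c : Labelling) = Rank (λ a b → a ≺⟨ c ⟩ b) (≺? c) (≺-irrefl c) (≺-trans c) (≺-connex c)
      open Rankᶜ using (rank; toℕ-rank; rank-monotone; rank-IsPerm; rank-unique; monotone-reflects)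

      rank-cong : ∀ {c c′} → c ≗ c′ → rank c ≗ rank c′
      rank-cong {c} {c′} c≗c′ q = sym (rank-unique c (rank-IsPerm c′) (rank-monotone c′ ∘ ≺-resp c≗c′) q)

      blockOf-rank : ∀ {c} → HasContent c → ∀ q → Bα.blockOf (rank c q) ≡ c q
      blockOf-rank {c} content q = Finₚ.toℕ-injective (begin
        toℕ (Bα.blockOf (rank c q))                      ≡⟨ Bα.toℕ-blockOf (rank c q) ⟩
        block α (toℕ (rank c q))                         ≡⟨ cong (block α) (trans (toℕ-rank c q) (count-⊎ lower tied disjoint)) ⟩
        block α (count (does ∘ lower) + count (does ∘ tied))
          ≡⟨ cong (λ x → block α (x + count (does ∘ tied))) (count-labels-below content (toℕ (c q)) (<⇒≤ (Finₚ.toℕ<n (c q)))) ⟩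
        block α (start α (toℕ (c q)) + count (does ∘ tied)) ≡⟨ block-start+ α (c q) _ tied<size ⟩
        toℕ (c q)                                         ∎)
        where
        open ≡-Reasoning
        lower : ∀ r → Dec (c r Fin.< c q)
        lower r = c r Fin.<? c q
        tied : ∀ r → Dec (c r ≡ c q × p r Fin.< p q)
        tied r = (c r Fin.≟ c q) ×-dec (p r Fin.<? p q)
        disjoint : ∀ r → c r Fin.< c q → ¬ (c r ≡ c q × p r Fin.< p q)
        disjoint r cr<cq (cr≡cq , _) = <-irrefl (cong toℕ cr≡cq) cr<cq
        tied<size : count (does ∘ tied) < lookup α (c q)
        tied<size = subst (count (does ∘ tied) <_) (content (c q))
          (count-mono-< (λ r tied-r → dec-true (c r Fin.≟ c q) (proj₁ (true⇒witness (tied r) tied-r))) q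
                        (dec-false (tied q) λ (_ , pq<pq) → <-irrefl refl pq<pq) (dec-true (c q Fin.≟ c q) refl))

      LexIncreasing : Labelling → Set
      LexIncreasing c = WithinBlocks (λ a b → a ≺⟨ c ⟩ b)

      Factorisation : Fun n → Set
      Factorisation s = IsPerm s × DesSubset α s × DesSubset β (inv s ∘ p)

      factorisation? : ∀ s → Dec (Factorisation s)
      factorisation? s = isPerm? s ×-dec desSubset? α s ×-dec desSubset? β (inv s ∘ p)

      Admissible : Labelling → Set
      Admissible c = HasContent c × LexIncreasing c

      admissible? : ∀ c → Dec (Admissible c)
      admissible? c = hasContent? c ×-dec withinBlocks? (≺? c)

      Factorisation-resp : Respects≗ Factorisation
      Factorisation-resp s≗s′ (s-inj , desα , desβ) =
        IsPerm-resp s≗s′ s-inj , DesSubset-resp α s≗s′ desα , DesSubset-resp β (λ q → inv-cong s≗s′ (p q)) desβ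

      Admissible-resp : Respects≗ Admissible
      Admissible-resp c≗c′ (content , lex) = HasContent-resp c≗c′ content , λ a b adj a+1∉β → ≺-resp c≗c′ (lex a b adj a+1∉β)

      labelling : Fun n → Labelling
      labelling s = Bα.blockOf ∘ inv s ∘ p

      factorisation : Labelling → Fun n
      factorisation c = p ∘ inv (rank c)

      inv-factorisation : ∀ c q → inv (factorisation c) (p q) ≡ rank c q
      inv-factorisation c q = begin
        inv (factorisation c) (p q)                       ≡⟨ cong (inv (factorisation c) ∘ p) (inv-∘ (rank-IsPerm c) q) ⟨
        inv (factorisation c) (factorisation c (rank c q)) ≡⟨ inv-∘ (IsPerm-∘ p-inj (IsPerm-inv (rank-IsPerm c))) (rank c q) ⟩
        rank c q                                          ∎
        where open ≡-Reasoning

      labelling-admissible : ∀ {s} → Factorisation s → Admissible (labelling s)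
      labelling-admissible {s} (s-inj , desα , desβ) = content , lex
        where
        u-inj : IsPerm (inv s ∘ p)
        u-inj = IsPerm-∘ (IsPerm-inv s-inj) p-inj
        content : HasContent (labelling s)
        content i = begin
          count (λ q → does (Bα.blockOf (inv s (p q)) Fin.≟ i))  ≡⟨ count-∘-perm (λ a → does (Bα.blockOf a Fin.≟ i)) u-inj ⟩
          count (λ a → does (Bα.blockOf a Fin.≟ i))              ≡⟨ Bα.count-blockOf (λ j → does (j Fin.≟ i)) ⟩
          ∑ (λ j → when (j Fin.≟ i) (lookup α j)) (allFin _)     ≡⟨ ∑-allFin-δ i (lookup α) ⟩
          lookup α i                                             ∎
          where open ≡-Reasoning
        lex : LexIncreasing (labelling s)
        lex a b adj a+1∉β with ua<ub ← DesSubset⇒ascent β u-inj desβ adj a+1∉β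
                          with Finₚ.<-cmp (labelling s a) (labelling s b)
        ... | tri< la<lb _ _ = inj₁ la<lb
        ... | tri≈ _ la≡lb _ = inj₂ (la≡lb , subst₂ Fin._<_ (∘-inv s-inj (p a)) (∘-inv s-inj (p b))
                                               (ascending-within-α-blocks s-inj desα ua<ub (blockOf≡⇒sameBlock la≡lb)))
        ... | tri> _ _ lb<la = contradiction (blockOf-reflects-< lb<la) (<⇒≯ ua<ub)

      factorisation-valid : ∀ {c} → Admissible c → Factorisation (factorisation c)
      factorisation-valid {c} (content , lex) = g-inj , desα , desβ
        where
        v = rank c
        v-inj = rank-IsPerm c
        g-inj : IsPerm (factorisation c)
        g-inj = IsPerm-∘ p-inj (IsPerm-inv v-inj)
        desβ : DesSubset β (inv (factorisation c) ∘ p)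
        desβ = DesSubset-resp β (λ q → sym (inv-factorisation c q)) λ a b adj vb<va →
          case suc (toℕ a) ∈? partialSums β of λ where
            (yes a+1∈β)  → a+1∈β
            (no a+1∉β)   → contradiction vb<va (<⇒≯ (rank-monotone c (lex a b adj a+1∉β)))
        desα : DesSubset α (factorisation c)
        desα a b adj gb<ga with suc (toℕ a) ∈? partialSums α
        ... | yes a+1∈α = a+1∈α
        ... | no a+1∉α with monotone-reflects c (rank-monotone c) {inv v a} {inv v b}
                               (subst₂ Fin._<_ (sym (∘-inv v-inj a)) (sym (∘-inv v-inj b)) (Adjacent⇒< adj))
        ...   | inj₁ c<c = contradiction (cong toℕ same-label) (<⇒≢ c<c)
          where
          same-label : c (inv v a) ≡ c (inv v b)
          same-label = Finₚ.toℕ-injective (begin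
            toℕ (c (inv v a))                     ≡⟨ cong toℕ (blockOf-rank {c} content (inv v a)) ⟨
            toℕ (Bα.blockOf (v (inv v a)))        ≡⟨ trans (Bα.toℕ-blockOf _) (cong (block α ∘ toℕ) (∘-inv v-inj a)) ⟩
            block α (toℕ a)                       ≡⟨ Bα.adjacent-∉⇒sameBlock adj a+1∉α ⟩
            block α (toℕ b)                       ≡⟨ trans (Bα.toℕ-blockOf _) (cong (block α ∘ toℕ) (∘-inv v-inj b)) ⟨
            toℕ (Bα.blockOf (v (inv v b)))        ≡⟨ cong toℕ (blockOf-rank {c} content (inv v b)) ⟩
            toℕ (c (inv v b))                     ∎)
            where open ≡-Reasoning
        ...   | inj₂ (_ , ga<gb) = contradiction gb<ga (<⇒≯ ga<gb)

      factorisation-labelling : ∀ {s} → Factorisation s → factorisation (labelling s) ≗ s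
      factorisation-labelling {s} (s-inj , desα , _) a = begin
        p (inv (rank c) a)  ≡⟨ cong p (inv-cong u≗rank a) ⟨
        p (inv u a)         ≡⟨ ∘-inv s-inj (p (inv u a)) ⟨
        s (u (inv u a))     ≡⟨ cong s (∘-inv u-inj a) ⟩
        s a                 ∎
        where
        open ≡-Reasoning
        c = labelling s
        u = inv s ∘ p
        u-inj : IsPerm u
        u-inj = IsPerm-∘ (IsPerm-inv s-inj) p-inj
        u-monotone : Rankᶜ.StrictlyMonotone c u
        u-monotone {q} {q′} (inj₁ cq<cq′) = blockOf-reflects-< cq<cq′
        u-monotone {q} {q′} (inj₂ (cq≡cq′ , pq<pq′)) with Finₚ.<-cmp (u q) (u q′)
        ... | tri< uq<uq′ _ _ = uq<uq′
        ... | tri≈ _ uq≡uq′ _ = contradiction (cong p (u-inj q q′ uq≡uq′)) (Finₚ.<⇒≢ pq<pq′)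
        ... | tri> _ _ uq′<uq = contradiction
              (subst₂ Fin._<_ (∘-inv s-inj (p q′)) (∘-inv s-inj (p q))
                (ascending-within-α-blocks s-inj desα uq′<uq (sym (blockOf≡⇒sameBlock cq≡cq′))))
              (<⇒≯ pq<pq′)
        u≗rank : u ≗ rank c
        u≗rank = rank-unique c u-inj u-monotone

      labelling-factorisation : ∀ {c} → Admissible c → labelling (factorisation c) ≗ c
      labelling-factorisation {c} (content , _) q =
        trans (cong Bα.blockOf (inv-factorisation c q)) (blockOf-rank {c} content q)

      factorisations↔admissible : Correspondence Factorisation Admissible
      factorisations↔admissible = record
        { to        = labelling
        ; from      = factorisation
        ; to-cong   = λ s≗s′ q → cong Bα.blockOf (inv-cong s≗s′ (p q))
        ; from-cong = λ c≗c′ a → cong p (inv-cong (rank-cong c≗c′) a)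
        ; to-∈      = labelling-admissible
        ; from-∈    = factorisation-valid
        ; from∘to   = factorisation-labelling
        ; to∘from   = labelling-factorisation
        }

      LexIncreasing⇒WeaklyIncreasing : ∀ {c} → LexIncreasing c → WeaklyIncreasing c
      LexIncreasing⇒WeaklyIncreasing lex a b adj a+1∉β with lex a b adj a+1∉β
      ... | inj₁ ca<cb       = <⇒≤ ca<cb
      ... | inj₂ (ca≡cb , _) = ≤-reflexive (cong toℕ ca≡cb)

      LexIncreasing⇔DesSubset-γ : ∀ {c} → WeaklyIncreasing c → LexIncreasing c ⇔ DesSubset (γ c) p
      LexIncreasing⇔DesSubset-γ {c} weak = mk⇔ lex⇒des des⇒lex
        where
        lex⇒des : LexIncreasing c → DesSubset (γ c) p
        lex⇒des lex a b adj pb<pa with suc (toℕ a) ∈? partialSums β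
        ... | yes a+1∈β = ∈-γ⁺ c adj (inj₁ a+1∈β)
        ... | no a+1∉β with lex a b adj a+1∉β
        ...   | inj₁ ca<cb        = ∈-γ⁺ c adj (inj₂ (λ ca≡cb → <-irrefl (cong toℕ ca≡cb) ca<cb))
        ...   | inj₂ (_ , pa<pb)  = contradiction pb<pa (<⇒≯ pa<pb)
        des⇒lex : DesSubset (γ c) p → LexIncreasing c
        des⇒lex des a b adj a+1∉β with m≤n⇒m<n∨m≡n (weak a b adj a+1∉β)
        ... | inj₁ ca<cb = inj₁ ca<cb
        ... | inj₂ ca≡cb with Finₚ.<-cmp (p a) (p b)
        ...   | tri< pa<pb _ _ = inj₂ (Finₚ.toℕ-injective ca≡cb , pa<pb)
        ...   | tri≈ _ pa≡pb _ = contradiction (p-inj a b pa≡pb) (Finₚ.<⇒≢ (Adjacent⇒< adj))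
        ...   | tri> _ _ pb<pa = case ∈-γ⁻ c adj (des a b adj pb<pa) of λ where
                  (inj₁ a+1∈β)   → contradiction a+1∈β a+1∉β
                  (inj₂ ca≢cb)   → contradiction (Finₚ.toℕ-injective ca≡cb) ca≢cb

      Admissible×BlockConstant⇔ : ∀ c → (Admissible c × BlockConstant c) ⇔ (DesSubset β p × ContentConstant c)
      Admissible×BlockConstant⇔ c = mk⇔
        (λ ((content , lex) , const) → lex-const⇒des lex const , content , const)
        (λ (des , content , const) →
           (content , λ a b adj a+1∉β → inj₂ (const a b adj a+1∉β , DesSubset⇒ascent β p-inj des adj a+1∉β)) , const)
        where
        lex-const⇒des : LexIncreasing c → BlockConstant c → DesSubset β p
        lex-const⇒des lex const a b adj pb<pa with suc (toℕ a) ∈? partialSums β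
        ... | yes a+1∈β = a+1∈β
        ... | no a+1∉β with lex a b adj a+1∉β
        ...   | inj₁ ca<cb       = contradiction (cong toℕ (const a b adj a+1∉β)) (<⇒≢ ca<cb)
        ...   | inj₂ (_ , pa<pb) = contradiction pb<pa (<⇒≯ pa<pb)

      Admissible×¬BlockConstant⇔ : ∀ c → (Admissible c × ¬ BlockConstant c) ⇔ (Refining c × DesSubset (γ c) p)
      Admissible×¬BlockConstant⇔ c = mk⇔
        (λ ((content , lex) , ¬const) → let weak = LexIncreasing⇒WeaklyIncreasing lex in
           ((content , weak) , ¬const) , Equivalence.to (LexIncreasing⇔DesSubset-γ weak) lex)
        (λ (((content , weak) , ¬const) , des) → (content , Equivalence.from (LexIncreasing⇔DesSubset-γ weak) des) , ¬const)

      #factorisations : # factorisation? (allFuns n n) ≡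
                        when (desSubset? β p) (η β α) + # (λ c → desSubset? (γ c) p) refiningLabellings
      #factorisations = begin
        # factorisation? (allFuns n n)
          ≡⟨ #-correspondence factorisation? admissible? Factorisation-resp Admissible-resp factorisations↔admissible ⟩
        # admissible? L
          ≡⟨ #-split admissible? blockConstant? L ⟩
        # (λ c → admissible? c ×-dec blockConstant? c) L + # (λ c → admissible? c ×-dec ¬? (blockConstant? c)) L
          ≡⟨ cong₂ _+_ (#-cong (λ c → admissible? c ×-dec blockConstant? c) (λ c → desSubset? β p ×-dec contentConstant? c)
                                Admissible×BlockConstant⇔ L)
                       (#-cong (λ c → admissible? c ×-dec ¬? (blockConstant? c)) (λ c → refining? c ×-dec desSubset? (γ c) p)
                                Admissible×¬BlockConstant⇔ L) ⟩
        # (λ c → desSubset? β p ×-dec contentConstant? c) L + # (λ c → refining? c ×-dec desSubset? (γ c) p) L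
          ≡⟨ cong₂ _+_ (trans (#-const (desSubset? β p) contentConstant? L) (cong (when (desSubset? β p)) #contentConstant≡η))
                       (sym (#-filter refining? (λ c → desSubset? (γ c) p) L)) ⟩
        when (desSubset? β p) (η β α) + # (λ c → desSubset? (γ c) p) refiningLabellings ∎
        where
        open ≡-Reasoning
        L = allFuns n (length α)

    products : List (Fun n)
    products = concatMap (λ s → map (s ∘_) (descentClass n β)) (descentClass n α)

    refinedClasses : List (Fun n)
    refinedClasses = concatMap (descentClass n ∘ γ) refiningLabellings

    multiplicity-descentClass : ∀ δ (q : Fun n) → multiplicity (descentClass n δ) q ≡ when (isPerm? q ×-dec desSubset? δ q) 1
    multiplicity-descentClass δ q = #-descentClass δ q (q ≗?_) λ u → mk⇔ (sym ∘_) (sym ∘_)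

    factorsThrough? : ∀ (q s : Fun n) → Dec (IsPerm s × DesSubset α s × IsPerm (inv s ∘ q) × DesSubset β (inv s ∘ q))
    factorsThrough? q s = isPerm? s ×-dec desSubset? α s ×-dec isPerm? (inv s ∘ q) ×-dec desSubset? β (inv s ∘ q)

    multiplicity-products : ∀ (q : Fun n) → multiplicity products q ≡ # (factorsThrough? q) (allFuns n n)
    multiplicity-products q = begin
      multiplicity products q
        ≡⟨ ∑-concatMap _ _ (descentClass n α) ⟩
      ∑ (λ s → multiplicity (map (s ∘_) (descentClass n β)) q) (descentClass n α)
        ≡⟨ ∑-cong-All (descentClass-IsPerm n α) (λ s s-inj → trans (∑-map _ _ (descentClass n β))
             (#-descentClass β (inv s ∘ q) (λ u → q ≗? s ∘ u) (factor-through s-inj))) ⟩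
      # (λ s → isPerm? (inv s ∘ q) ×-dec desSubset? β (inv s ∘ q)) (descentClass n α)
        ≡⟨ trans (#-filter (desSubset? α) factors-β (filter isPerm? (allFuns n n)))
                 (#-filter isPerm? (λ s → desSubset? α s ×-dec factors-β s) (allFuns n n)) ⟩
      # (factorsThrough? q) (allFuns n n) ∎
      where
      open ≡-Reasoning
      factors-β : ∀ s → Dec (IsPerm (inv s ∘ q) × DesSubset β (inv s ∘ q))
      factors-β s = isPerm? (inv s ∘ q) ×-dec desSubset? β (inv s ∘ q)
      factor-through : ∀ {s} → IsPerm s → ∀ u → q ≗ s ∘ u ⇔ u ≗ inv s ∘ q
      factor-through {s} s-inj u = mk⇔ (λ q≗su i → trans (sym (inv-∘ s-inj (u i))) (cong (inv s) (sym (q≗su i))))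
                                       (λ u≗ i → trans (sym (∘-inv s-inj (q i))) (cong s (sym (u≗ i))))

    multiplicity-mackey : ∀ (q : Fun n) →
      multiplicity products q ≡ η β α * multiplicity (descentClass n β) q + multiplicity refinedClasses q
    multiplicity-mackey q with isPerm? q
    ... | yes q-inj = begin
      multiplicity products q
        ≡⟨ trans (multiplicity-products q) (#-cong (factorsThrough? q) factorisation? factorisation⇔ (allFuns n n)) ⟩
      # factorisation? (allFuns n n)         ≡⟨ #factorisations ⟩
      when (desSubset? β q) (η β α) + # (λ c → desSubset? (γ c) q) refiningLabellings
        ≡⟨ cong₂ _+_ (sym (*-when (desSubset? β q) (η β α))) (∑-cong refiningLabellings λ c → sym (when-perm (γ c))) ⟩
      η β α * when (desSubset? β q) 1 + ∑ (λ c → when (isPerm? q ×-dec desSubset? (γ c) q) 1) refiningLabellings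
        ≡⟨ cong₂ _+_ (cong (η β α *_) (trans (sym (when-perm β)) (sym (multiplicity-descentClass β q))))
                     (trans (∑-cong refiningLabellings λ c → sym (multiplicity-descentClass (γ c) q))
                            (sym (∑-concatMap _ _ refiningLabellings))) ⟩
      η β α * multiplicity (descentClass n β) q + multiplicity refinedClasses q ∎
      where
      open ≡-Reasoning
      open Factorisations q q-inj using (factorisation?; #factorisations)
      factorisation⇔ : ∀ s → (IsPerm s × DesSubset α s × IsPerm (inv s ∘ q) × DesSubset β (inv s ∘ q)) ⇔
                             (IsPerm s × DesSubset α s × DesSubset β (inv s ∘ q))
      factorisation⇔ s = mk⇔ (λ (s-inj , desα , _ , desβ) → s-inj , desα , desβ)
                             (λ (s-inj , desα , desβ) → s-inj , desα , IsPerm-∘ (IsPerm-inv s-inj) q-inj , desβ)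
      when-perm : ∀ δ → when (isPerm? q ×-dec desSubset? δ q) 1 ≡ when (desSubset? δ q) 1
      when-perm δ = when-cong (isPerm? q ×-dec desSubset? δ q) (desSubset? δ q) (mk⇔ proj₂ (q-inj ,_)) refl
    ... | no ¬q-inj = begin
      multiplicity products q
        ≡⟨ trans (multiplicity-products q)
                 (#-none (factorsThrough? q) (λ s (_ , _ , perm , _) → ¬q-inj λ i j eq → perm i j (cong (inv s) eq)) (allFuns n n)) ⟩
      0
        ≡⟨ cong₂ _+_ (trans (cong (η β α *_) (trans (multiplicity-descentClass β q) (no-perm β))) (*-zeroʳ (η β α)))
                     (trans (∑-concatMap _ _ refiningLabellings)
                       (trans (∑-cong refiningLabellings λ c → trans (multiplicity-descentClass (γ c) q) (no-perm (γ c)))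
                              (∑-0# refiningLabellings))) ⟨
      η β α * multiplicity (descentClass n β) q + multiplicity refinedClasses q ∎
      where
      open ≡-Reasoning
      no-perm : ∀ δ → when (isPerm? q ×-dec desSubset? δ q) 1 ≡ 0
      no-perm δ = when-¬ (isPerm? q ×-dec desSubset? δ q) (¬q-inj ∘ proj₁)

module GroupAlgebraMackey {c ℓ} (K : CommutativeRing c ℓ) (n : ℕ) where

  open import Data.List using ([]; _∷_; map; _++_; concatMap; length)
  open import Data.Product using (_×_; _,_; proj₁; proj₂)
  open import Data.List.Relation.Unary.All as All using (All)
  import Data.List.Relation.Unary.All.Properties as Allₚ
  import Data.Nat as ℕ
  open import Function using (_∘_)
  open import Function.Bundles using (_⇔_; mk⇔)
  open import Relation.Binary.PropositionalEquality as ≡ using (_≗_)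
  open import Data.Bool using (if_then_else_)
  open import Relation.Nullary using (Dec; yes; no; does)

  open CommutativeRing K renaming (Carrier to k)
  open GroupAlgebra K n
  open ListSums +-commutativeMonoid
  open import Relation.Binary.Reasoning.Setoid setoid
  open import Algebra.Properties.Ring ring using (-1*x≈-x)
  open Combinatorics using (inv; inv-cong; ∘-inv; inv-∘; inv-of-∘; descentClass; descentClass-IsPerm; multiplicity)

  coeff≈∑ : ∀ x w → coeff x w ≈ ∑ (λ t → when (proj₂ t ≐? w) (proj₁ t)) x
  coeff≈∑ []      w = refl
  coeff≈∑ (t ∷ x) w = step (proj₂ t ≐? w) (coeff≈∑ x w)
    where
    step : ∀ {p} {P : Set p} (P? : Dec P) {acc acc′} → acc ≈ acc′ →
           (if does P? then proj₁ t + acc else acc) ≈ when P? (proj₁ t) + acc′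
    step (yes _) acc≈ = +-congˡ acc≈
    step (no _)  acc≈ = trans acc≈ (sym (+-identityˡ _))

  coeff-resp : ∀ x {w w′} → w ≗ w′ → coeff x w ≈ coeff x w′
  coeff-resp x {w} {w′} w≗w′ = begin
    coeff x w                                   ≈⟨ coeff≈∑ x w ⟩
    ∑ (λ t → when (proj₂ t ≐? w) (proj₁ t)) x   ≈⟨ ∑-cong x (λ t → when-cong (proj₂ t ≐? w) (proj₂ t ≐? w′) (≗-w⇔≗-w′ (proj₂ t)) refl) ⟩
    ∑ (λ t → when (proj₂ t ≐? w′) (proj₁ t)) x  ≈⟨ coeff≈∑ x w′ ⟨
    coeff x w′                                  ∎
    where
    ≗-w⇔≗-w′ : ∀ u → (∀ i → u i ≡.≡ w i) ⇔ (∀ i → u i ≡.≡ w′ i)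
    ≗-w⇔≗-w′ u = mk⇔ (λ eq i → ≡.trans (eq i) (w≗w′ i)) (λ eq i → ≡.trans (eq i) (≡.sym (w≗w′ i)))

  coeff-+ₐ : ∀ x y w → coeff (x +ₐ y) w ≈ coeff x w + coeff y w
  coeff-+ₐ x y w = begin
    coeff (x ++ y) w            ≈⟨ coeff≈∑ (x ++ y) w ⟩
    ∑ coeffTerm (x ++ y)        ≈⟨ ∑-++ coeffTerm x y ⟩
    ∑ coeffTerm x + ∑ coeffTerm y ≈⟨ +-cong (coeff≈∑ x w) (coeff≈∑ y w) ⟨
    coeff x w + coeff y w       ∎
    where
    coeffTerm : k × Fun n → k
    coeffTerm t = when (proj₂ t ≐? w) (proj₁ t)

  ∑-*ˡ : ∀ {a} {A : Set a} r (f : A → k) xs → r * ∑ f xs ≈ ∑ (λ x → r * f x) xs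
  ∑-*ˡ r f []       = zeroʳ r
  ∑-*ˡ r f (x ∷ xs) = trans (distribˡ r (f x) (∑ f xs)) (+-congˡ (∑-*ˡ r f xs))

  when-*ˡ : ∀ {p} {P : Set p} (P? : Dec P) r x → when P? (r * x) ≈ r * when P? x
  when-*ˡ (yes _) r x = refl
  when-*ˡ (no _)  r x = sym (zeroʳ r)

  coeff-• : ∀ r x w → coeff (r • x) w ≈ r * coeff x w
  coeff-• r x w = begin
    coeff (r • x) w                                        ≈⟨ trans (coeff≈∑ (r • x) w) (∑-map _ _ x) ⟩
    ∑ (λ t → when (proj₂ t ≐? w) (r * proj₁ t)) x          ≈⟨ ∑-cong x (λ t → when-*ˡ (proj₂ t ≐? w) r (proj₁ t)) ⟩
    ∑ (λ t → r * when (proj₂ t ≐? w) (proj₁ t)) x          ≈⟨ ∑-*ˡ r _ x ⟨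
    r * ∑ (λ t → when (proj₂ t ≐? w) (proj₁ t)) x          ≈⟨ *-congˡ (coeff≈∑ x w) ⟨
    r * coeff x w                                          ∎

  coeff--ₐ : ∀ x y w → coeff (x -ₐ y) w ≈ coeff x w - coeff y w
  coeff--ₐ x y w = trans (coeff-+ₐ x _ w) (+-congˡ (trans (coeff-• (- 1#) y w) (-1*x≈-x _)))

  coeff-sumₐ : ∀ zs w → coeff (sumₐ zs) w ≈ ∑ (λ z → coeff z w) zs
  coeff-sumₐ []       w = refl
  coeff-sumₐ (z ∷ zs) w = trans (coeff-+ₐ z (sumₐ zs) w) (+-congˡ (coeff-sumₐ zs w))

  coeff-B*ₐ : ∀ γ y w → coeff (B γ *ₐ y) w ≈ ∑ (λ s → coeff y (inv s ∘ w)) (descentClass n γ)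
  coeff-B*ₐ γ y w = begin
    coeff (B γ *ₐ y) w
      ≈⟨ trans (coeff≈∑ (B γ *ₐ y) w) (trans (∑-concatMap _ _ (B γ)) (∑-map _ _ (descentClass n γ))) ⟩
    ∑ (λ s → ∑ (λ t → when (proj₂ t ≐? w) (proj₁ t)) (map (λ t → 1# * proj₁ t , s ∘ proj₂ t) y)) (descentClass n γ)
      ≈⟨ ∑-cong-All (descentClass-IsPerm n γ) (λ s s-inj → trans (∑-map _ _ y) (trans (∑-cong y λ t →
           when-cong ((s ∘ proj₂ t) ≐? w) (proj₂ t ≐? (inv s ∘ w)) (shift s-inj t) (*-identityˡ _)) (sym (coeff≈∑ y (inv s ∘ w))))) ⟩
    ∑ (λ s → coeff y (inv s ∘ w)) (descentClass n γ) ∎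
    where
    shift : ∀ {s} → IsPerm s → ∀ (t : k × Fun n) → (s ∘ proj₂ t ≗ w) ⇔ (proj₂ t ≗ inv s ∘ w)
    shift {s} s-inj t = mk⇔ (λ eq i → ≡.trans (≡.sym (inv-∘ s-inj (proj₂ t i))) (≡.cong (inv s) (eq i)))
                            (λ eq i → ≡.trans (≡.cong s (eq i)) (∘-inv s-inj (w i)))

  coeff-B*ₐ-cong : ∀ γ {y y′} → y ≈ₐ y′ → ∀ w → coeff (B γ *ₐ y) w ≈ coeff (B γ *ₐ y′) w
  coeff-B*ₐ-cong γ {y} {y′} y≈y′ w =
    trans (coeff-B*ₐ γ y w) (trans (∑-cong (descentClass n γ) (λ s → y≈y′ (inv s ∘ w))) (sym (coeff-B*ₐ γ y′ w)))

  fromℕ-+ : ∀ a b → fromℕ (a ℕ.+ b) ≈ fromℕ a + fromℕ b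
  fromℕ-+ ℕ.zero    b = sym (+-identityˡ _)
  fromℕ-+ (ℕ.suc a) b = trans (+-congˡ (fromℕ-+ a b)) (sym (+-assoc _ _ _))

  fromℕ-* : ∀ a b → fromℕ (a ℕ.* b) ≈ fromℕ a * fromℕ b
  fromℕ-* ℕ.zero    b = sym (zeroˡ _)
  fromℕ-* (ℕ.suc a) b =
    trans (fromℕ-+ b (a ℕ.* b)) (trans (+-cong (sym (*-identityˡ _)) (fromℕ-* a b)) (sym (distribʳ _ _ _)))

  when≈fromℕ-when* : ∀ {p} {P : Set p} (P? : Dec P) r → when P? r ≈ fromℕ (Combinatorics.when P? 1) * r
  when≈fromℕ-when* (yes _) r = sym (trans (*-congʳ (+-identityʳ 1#)) (*-identityˡ r))
  when≈fromℕ-when* (no _)  r = sym (zeroˡ r)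

  ∑-by-multiplicity : ∀ (Φ : Fun n → k) → (∀ {f f′} → f ≗ f′ → Φ f ≈ Φ f′) →
                      ∀ Z → ∑ Φ Z ≈ ∑ (λ q → fromℕ (multiplicity Z q) * Φ q) (allFuns n n)
  ∑-by-multiplicity Φ Φ-resp []      = sym (trans (∑-cong (allFuns n n) (λ q → zeroˡ (Φ q))) (∑-0# (allFuns n n)))
  ∑-by-multiplicity Φ Φ-resp (z ∷ Z) = begin
    Φ z + ∑ Φ Z
      ≈⟨ +-cong (sym (∑-allFuns-δ n n z Φ Φ-resp)) (∑-by-multiplicity Φ Φ-resp Z) ⟩
    ∑ (λ q → when (q ≗? z) (Φ q)) (allFuns n n) + ∑ (λ q → fromℕ (multiplicity Z q) * Φ q) (allFuns n n)
      ≈⟨ ∑-+ _ _ (allFuns n n) ⟨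
    ∑ (λ q → when (q ≗? z) (Φ q) + fromℕ (multiplicity Z q) * Φ q) (allFuns n n)
      ≈⟨ ∑-cong (allFuns n n) (λ q → trans (+-congʳ (when≈fromℕ-when* (q ≗? z) (Φ q)))
           (trans (sym (distribʳ (Φ q) _ _)) (*-congʳ (sym (fromℕ-+ (Combinatorics.when (q ≗? z) 1) (multiplicity Z q)))))) ⟩
    ∑ (λ q → fromℕ (multiplicity (z ∷ Z) q) * Φ q) (allFuns n n) ∎

  module Mackey (α β : List ℕ) (α-comp : IsComposition n α) (β-comp : IsComposition n β) where

    open Combinatorics.Mackey α β α-comp β-comp public using (γ; refiningLabellings)
    open Combinatorics.Mackey α β α-comp β-comp
      using (refining?; γ-IsComposition; γ-strictlyRefines; products; refinedClasses; multiplicity-mackey)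

    ∑-products : ∀ (Φ : Fun n → k) → (∀ {f f′} → f ≗ f′ → Φ f ≈ Φ f′) →
                 ∑ Φ products ≈ fromℕ (η β α) * ∑ Φ (descentClass n β) + ∑ Φ refinedClasses
    ∑-products Φ Φ-resp = begin
      ∑ Φ products
        ≈⟨ ∑-by-multiplicity Φ Φ-resp products ⟩
      ∑ (λ q → fromℕ (multiplicity products q) * Φ q) L
        ≈⟨ ∑-cong L (λ q → *-congʳ (trans (reflexive (≡.cong fromℕ (multiplicity-mackey q)))
             (trans (fromℕ-+ (η β α ℕ.* multiplicity (descentClass n β) q) (multiplicity refinedClasses q))
                    (+-congʳ (fromℕ-* (η β α) (multiplicity (descentClass n β) q)))))) ⟩
      ∑ (λ q → (fromℕ (η β α) * fromℕ (multiplicity (descentClass n β) q) + fromℕ (multiplicity refinedClasses q)) * Φ q) L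
        ≈⟨ ∑-cong L (λ q → trans (distribʳ (Φ q) _ _) (+-congʳ (*-assoc _ _ _))) ⟩
      ∑ (λ q → fromℕ (η β α) * (fromℕ (multiplicity (descentClass n β) q) * Φ q) + fromℕ (multiplicity refinedClasses q) * Φ q) L
        ≈⟨ trans (∑-+ _ _ L) (+-congʳ (sym (∑-*ˡ (fromℕ (η β α)) _ L))) ⟩
      fromℕ (η β α) * ∑ (λ q → fromℕ (multiplicity (descentClass n β) q) * Φ q) L + ∑ (λ q → fromℕ (multiplicity refinedClasses q) * Φ q) L
        ≈⟨ +-cong (*-congˡ (∑-by-multiplicity Φ Φ-resp (descentClass n β))) (∑-by-multiplicity Φ Φ-resp refinedClasses) ⟨
      fromℕ (η β α) * ∑ Φ (descentClass n β) + ∑ Φ refinedClasses ∎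
      where
      L = allFuns n n

    coeff-B*ₐB*ₐ : ∀ a v → coeff (B α *ₐ (B β *ₐ a)) v ≈
                   fromℕ (η β α) * coeff (B β *ₐ a) v + coeff (sumₐ (map (λ c → B (γ c) *ₐ a) refiningLabellings)) v
    coeff-B*ₐB*ₐ a v = begin
      coeff (B α *ₐ (B β *ₐ a)) v
        ≈⟨ coeff-B*ₐ α (B β *ₐ a) v ⟩
      ∑ (λ s → coeff (B β *ₐ a) (inv s ∘ v)) Dα
        ≈⟨ ∑-cong-All (descentClass-IsPerm n α) (λ s s-inj → trans (coeff-B*ₐ β a (inv s ∘ v))
             (∑-cong-All (descentClass-IsPerm n β) λ u u-inj → coeff-resp a (λ i → ≡.sym (inv-of-∘ s-inj u-inj (v i))))) ⟩
      ∑ (λ s → ∑ (λ u → Φ (s ∘ u)) Dβ) Dα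
        ≈⟨ trans (∑-concatMap Φ _ Dα) (∑-cong Dα λ s → ∑-map Φ (s ∘_) Dβ) ⟨
      ∑ Φ products
        ≈⟨ ∑-products Φ (λ f≗f′ → coeff-resp a (λ i → inv-cong f≗f′ (v i))) ⟩
      fromℕ (η β α) * ∑ Φ Dβ + ∑ Φ refinedClasses
        ≈⟨ +-cong (*-congˡ (sym (coeff-B*ₐ β a v))) (trans (∑-concatMap Φ _ refiningLabellings)
             (∑-cong refiningLabellings λ c → sym (coeff-B*ₐ (γ c) a v))) ⟩
      fromℕ (η β α) * coeff (B β *ₐ a) v + ∑ (λ c → coeff (B (γ c) *ₐ a) v) refiningLabellings
        ≈⟨ +-congˡ (trans (sym (∑-map (λ z → coeff z v) (λ c → B (γ c) *ₐ a) refiningLabellings))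
                          (sym (coeff-sumₐ (map (λ c → B (γ c) *ₐ a) refiningLabellings) v))) ⟩
      fromℕ (η β α) * coeff (B β *ₐ a) v + coeff (sumₐ (map (λ c → B (γ c) *ₐ a) refiningLabellings)) v ∎
      where
      Dα = descentClass n α
      Dβ = descentClass n β
      Φ : Fun n → k
      Φ q = coeff a (inv q ∘ v)

    refinements-valid : ∀ {a} → InA a → All (λ p → IsComposition n (proj₁ p) × StrictlyRefines (proj₁ p) β × InA (proj₂ p))
                                         (map (λ c → γ c , a) refiningLabellings)
    refinements-valid a∈A = Allₚ.map⁺ (All.map (λ (_ , ¬const) → γ-IsComposition ¬const , γ-strictlyRefines ¬const , a∈A)
                                               (Allₚ.all-filter refining? (allFuns n (length α))))

theorem2p8 : ∀ {c ℓ} (K : CommutativeRing c ℓ) (n : ℕ) (α β : List ℕ) →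
    IsComposition n α → IsComposition n β →
    let open GroupAlgebra K n in
    ∀ (x : Elem) → InR β x →
    InRefSum β ((B α *ₐ x) -ₐ (fromℕ (η β α) • x))
theorem2p8 K n α β α-comp β-comp x (a , a∈A , x≈Bβa) =
  map (λ c → γ c , a) refiningLabellings , refinements-valid a∈A , λ v → begin
    coeff ((B α *ₐ x) -ₐ (fromℕ (η β α) • x)) v
      ≈⟨ coeff--ₐ (B α *ₐ x) (fromℕ (η β α) • x) v ⟩
    coeff (B α *ₐ x) v - coeff (fromℕ (η β α) • x) v
      ≈⟨ +-cong (coeff-B*ₐ-cong α x≈Bβa v) (-‿cong (trans (coeff-• (fromℕ (η β α)) x v) (*-congˡ (x≈Bβa v)))) ⟩
    coeff (B α *ₐ (B β *ₐ a)) v - fromℕ (η β α) * coeff (B β *ₐ a) v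
      ≈⟨ +-congʳ (coeff-B*ₐB*ₐ a v) ⟩
    fromℕ (η β α) * coeff (B β *ₐ a) v + coeff (sumₐ (map (λ c → B (γ c) *ₐ a) refiningLabellings)) v
      - fromℕ (η β α) * coeff (B β *ₐ a) v
      ≈⟨ xyx⁻¹≈y _ _ ⟩
    coeff (sumₐ (map (λ c → B (γ c) *ₐ a) refiningLabellings)) v
      ≡⟨ ≡.cong (λ zs → coeff (sumₐ zs) v) (map-∘ refiningLabellings) ⟩
    coeff (sumₐ (map (λ p → B (proj₁ p) *ₐ proj₂ p) (map (λ c → γ c , a) refiningLabellings))) v ∎
  where
  open CommutativeRing K
  open GroupAlgebra K n
  open GroupAlgebraMackey K n
  open Mackey α β α-comp β-comp
  open SetoidReasoning setoid
  open AbelianGroupProperties +-abelianGroup using (xyx⁻¹≈y)
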